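{- Let $m\ge1$ and $\overline{l} = ( l_0, \ldots, l_m)^T \in \mathbb Z_{\ge 1}^{m+1}$, $L=l_0+\dots+l_m$. Treat $\alpha_1,\dots,\alpha_m$ as indeterminates and set $\alpha_0=0$. Define $\sigma_i\in\mathbb{Z}[\alpha_1,\dots,\alpha_m]$ by $\prod_{j=0}^m(\alpha_j-w)^{l_j}=\sum_{i=0}^L\sigma_i w^i$, let $A_{\overline{l},0}(t)=\sum_{i=l_0}^{L}t^{L-i}\, i!\, \sigma_i$, and for $j=1,\dots,m$ let $A_{\overline{l},j}(t)$ be the polynomial obtained by keeping the terms of $t$-degree at most $L$ in the power series $e^{\alpha_j t}A_{\overline{l},0}(t)\in\mathbb{Q}[\alpha_1,\dots,\alpha_m][[t]]$. Then $\frac{1}{l_j!}A_{\overline{l},j}(t)\in \mathbb{Z}[t,\alpha_1, \ldots ,\alpha_m]$ for all $j = 0, 1, \ldots, m$.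
   Context: For $j\ge1$, the truncation $A_{\overline{l},j}$ is the polynomial for which $e^{\alpha_j t}A_{\overline{l},0}(t)-A_{\overline{l},j}(t)$ vanishes to order at least $L+1$ at $t=0$ (it has degree $L-l_j$). -}

module Defs where

open import Data.Nat as ℕ using (ℕ; zero; suc; _∸_; _!; _≤?_)
open import Data.Nat.Properties using (_!≢0)
open import Data.Integer as ℤ using (ℤ; +_)
open import Data.Rational as ℚ using (ℚ; 0ℚ; 1ℚ)
open import Data.Fin using (Fin; zero; suc)
open import Data.Vec as Vec using (Vec; []; _∷_; replicate; zipWith; lookup)
open import Data.Vec.Properties using (≡-dec)
open import Data.List as List using (List; []; _∷_; _++_; concatMap; filter; map; foldr)
open import Data.Product using (_×_; _,_; ∃)
open import Relation.Binary.PropositionalEquality using (_≡_)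
open import Relation.Nullary.Decidable using (_×-dec_)

-- A polynomial in ℚ[t, α₁, …, αₘ], represented as a finite formal sum of
-- monomials  c · t^d · α^e  (c : ℚ, d : ℕ, e : Vec ℕ m); a triple (c , d , e).
-- The same representation is used for ℚ[w, α₁,…,αₘ] (with w in place of t).
Mono : ℕ → Set
Mono m = ℚ × ℕ × Vec ℕ m

Poly : ℕ → Set
Poly m = List (Mono m)

module _ {m : ℕ} where

  zeroP : Poly m
  zeroP = []

  constP : ℚ → Poly m
  constP c = (c , 0 , replicate m 0) ∷ []

  tP : Poly m
  tP = (1ℚ , 1 , replicate m 0) ∷ []

  _+P_ : Poly m → Poly m → Poly m
  p +P q = p ++ q

  scaleP : ℚ → Poly m → Poly m
  scaleP c = map (λ { (a , d , e) → (c ℚ.* a , d , e) })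

  negP : Poly m → Poly m
  negP = scaleP (ℚ.- 1ℚ)

  _*P_ : Poly m → Poly m → Poly m
  p *P q = concatMap (λ { (a , d , e) →
             map (λ { (b , d′ , e′) → (a ℚ.* b , d ℕ.+ d′ , zipWith ℕ._+_ e e′) }) q }) p

  _^P_ : Poly m → ℕ → Poly m
  p ^P zero = constP 1ℚ
  p ^P suc k = p *P (p ^P k)

  sumP : List (Poly m) → Poly m
  sumP = foldr _+P_ zeroP

  coeff : Poly m → ℕ → Vec ℕ m → ℚ
  coeff p d e = foldr (λ { (a , d′ , e′) s → a ℚ.+ s }) 0ℚ
                  (filter (λ { (_ , d′ , e′) → (d′ ℕ.≟ d) ×-dec ≡-dec ℕ._≟_ e′ e }) p)

  tCoeff : Poly m → ℕ → Poly m
  tCoeff p i = map (λ { (a , _ , e) → (a , 0 , e) }) (filter (λ { (_ , d , _) → d ℕ.≟ i }) p)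

  truncP : ℕ → Poly m → Poly m
  truncP N = filter (λ { (_ , d , _) → d ≤? N })

unitVec : ∀ {m} → Fin m → Vec ℕ m
unitVec zero = 1 ∷ replicate _ 0
unitVec (suc k) = 0 ∷ unitVec k

alpha : ∀ {m} → Fin (suc m) → Poly m
alpha zero = zeroP
alpha {m} (suc k) = (1ℚ , 0 , unitVec k) ∷ []

fact : ℕ → ℚ
fact i = (+ (i !)) ℚ./ 1

invFact : ℕ → ℚ
invFact i = (+ 1) ℚ./ (i !) where instance _ = i !≢0

totalL : ∀ {n} → Vec ℕ n → ℕ
totalL = Vec.sum

prodP : ∀ {m} → Vec ℕ (suc m) → Poly m
prodP {m} l = sumP′ (Vec.toList (Vec.tabulate (λ j → (alpha j +P negP tP) ^P lookup l j)))
  where sumP′ : List (Poly m) → Poly m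
        sumP′ = foldr _*P_ (constP 1ℚ)

sigma : ∀ {m} → Vec ℕ (suc m) → ℕ → Poly m
sigma l i = tCoeff (prodP l) i

range : ℕ → ℕ → List ℕ
range a b = List.map (a ℕ.+_) (List.upTo (suc b ∸ a))

A0 : ∀ {m} → Vec ℕ (suc m) → Poly m
A0 l = sumP (List.map (λ i → (tP ^P (L ∸ i)) *P scaleP (fact i) (sigma l i))
                      (range (Vec.head l) L))
  where L = totalL l

expTrunc : ∀ {m} → ℕ → Poly m → Poly m
expTrunc N a = sumP (List.map (λ k → scaleP (invFact k) ((a *P tP) ^P k)) (List.upTo (suc N)))

-- A_{l,j}(t): j = 0 gives A_{l,0}; for j ≥ 1, the terms of t-degree ≤ L of
-- e^{α_j t} A_{l,0}(t) (the exponential truncated at degree L contributes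
-- exactly these terms, since A_{l,0} has only nonnegative t-degrees)
A : ∀ {m} → Vec ℕ (suc m) → Fin (suc m) → Poly m
A l zero = A0 l
A l (suc k) = truncP L (expTrunc L (alpha (suc k)) *P A0 l)
  where L = totalL l

IsInteger : ℚ → Set
IsInteger q = ∃ λ (z : ℤ) → q ≡ z ℚ./ 1

InZPoly : ∀ {m} → Poly m → Set
InZPoly {m} p = ∀ (d : ℕ) (e : Vec ℕ m) → IsInteger (coeff p d e)

module Submission where

-- Write P(w) = ∏ⱼ (αⱼ − w)^lⱼ = Σᵢ σᵢ wⁱ. Monomial by monomial, A_{l,0} sends c wⁱ α^e to c i! t^(L−i) α^e,
-- and every such i lies in [l₀, L] because (−w)^l₀ divides P; so l₀! divides all coefficients of A_{l,0}.
-- For j ≥ 1, the coefficient of tⁿ (n ≤ L) in e^{αⱼ t} A_{l,0}(t) is s! times the coefficient of w^s in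
-- P(w + αⱼ), where s = L − n: the exponential series and the binomial expansion of (w + αⱼ)ⁱ match term by
-- term. Now P(w + αⱼ) has integer coefficients and is divisible by (−w)^lⱼ, so its w^s coefficient vanishes
-- for s < lⱼ, while lⱼ! ∣ s! for s ≥ lⱼ.

open import Defs
open import Algebra.Bundles using (CommutativeMonoid)
import Algebra.Properties.CommutativeSemigroup as CommSemigroupProperties
open import Data.Empty using (⊥-elim)
open import Data.Fin using (Fin; zero; suc)
open import Data.Integer as ℤ using (ℤ; +_)
import Data.Integer.GCD as ℤG
import Data.Integer.Properties as ℤP
open import Data.List as List using (List; []; _∷_; _++_; map; concatMap; concat; filter; foldr; applyUpTo; upTo)
open import Data.List.Properties using (map-++; concat-++; ++-identityʳ; concatMap-map; concatMap-pure)
open import Data.List.Relation.Unary.All as All using (All; []; _∷_)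
import Data.List.Relation.Unary.All.Properties as AllP
open import Data.Nat as ℕ using (ℕ; zero; suc; _≤_; _<_; z≤n; s≤s; _∸_; _!)
open import Data.Nat.Combinatorics using (_C_; nCk+nC[k+1]≡[n+1]C[k+1]; k>n⇒nCk≡0; nCk≡n!/k![n-k]!; k![n∸k]!∣n!)
import Data.Nat.Coprimality as Coprime
open import Data.Nat.Divisibility using (divides; m≤n⇒m!∣n!)
open import Data.Nat.DivMod using (m/n*n≡m)
import Data.Nat.Properties as ℕP
open import Data.Product using (_×_; _,_; proj₁; proj₂)
open import Data.Rational as ℚ using (ℚ; 0ℚ; 1ℚ)
import Data.Rational.Properties as ℚP
open import Data.Rational.Solver using (module +-*-Solver)
open import Data.Vec as Vec using (Vec; []; _∷_; zipWith; replicate; lookup; tabulate; toList)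
open import Data.Vec.Properties using (≡-dec; zipWith-comm; zipWith-assoc; zipWith-identityˡ; zipWith-identityʳ)
open import Function using (_∘_)
open import Level using (0ℓ)
open import Relation.Binary.Bundles using (Setoid)
open import Relation.Binary.PropositionalEquality
import Relation.Binary.Reasoning.Setoid as SetoidReasoning
open import Relation.Nullary using (Dec; yes; no; ¬_)
open import Relation.Nullary.Decidable using (_×-dec_)

open CommSemigroupProperties (CommutativeMonoid.commutativeSemigroup ℚP.+-0-commutativeMonoid)
  using (interchange)
open CommSemigroupProperties (CommutativeMonoid.commutativeSemigroup ℚP.*-1-commutativeMonoid)
  using (x∙yz≈y∙xz)

sumQ : {A : Set} → (A → ℚ) → List A → ℚ
sumQ f [] = 0ℚ
sumQ f (x ∷ xs) = f x ℚ.+ sumQ f xs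

module _ {A : Set} where

  foldr-sumQ : (f : A → ℚ) (xs : List A) → foldr (λ x s → f x ℚ.+ s) 0ℚ xs ≡ sumQ f xs
  foldr-sumQ f [] = refl
  foldr-sumQ f (x ∷ xs) = cong (f x ℚ.+_) (foldr-sumQ f xs)

  sumQ-++ : (f : A → ℚ) (xs ys : List A) → sumQ f (xs ++ ys) ≡ sumQ f xs ℚ.+ sumQ f ys
  sumQ-++ f [] ys = sym (ℚP.+-identityˡ _)
  sumQ-++ f (x ∷ xs) ys = trans (cong (f x ℚ.+_) (sumQ-++ f xs ys)) (sym (ℚP.+-assoc (f x) _ _))

  sumQ-cong-All : {f g : A → ℚ} (xs : List A) → All (λ x → f x ≡ g x) xs → sumQ f xs ≡ sumQ g xs
  sumQ-cong-All [] [] = refl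
  sumQ-cong-All (x ∷ xs) (h ∷ hs) = cong₂ ℚ._+_ h (sumQ-cong-All xs hs)

  sumQ-cong : {f g : A → ℚ} → (∀ x → f x ≡ g x) → (xs : List A) → sumQ f xs ≡ sumQ g xs
  sumQ-cong h xs = sumQ-cong-All xs (All.tabulate (λ {x} _ → h x))

  sumQ-zero : {f : A → ℚ} (xs : List A) → All (λ x → f x ≡ 0ℚ) xs → sumQ f xs ≡ 0ℚ
  sumQ-zero [] [] = refl
  sumQ-zero (x ∷ xs) (h ∷ hs) = cong₂ ℚ._+_ h (sumQ-zero xs hs)

  sumQ-+ : (f g : A → ℚ) (xs : List A) → sumQ (λ x → f x ℚ.+ g x) xs ≡ sumQ f xs ℚ.+ sumQ g xs
  sumQ-+ f g [] = refl
  sumQ-+ f g (x ∷ xs) = trans (cong ((f x ℚ.+ g x) ℚ.+_) (sumQ-+ f g xs)) (interchange (f x) (g x) _ _)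

  *-sumQ : (c : ℚ) (f : A → ℚ) (xs : List A) → c ℚ.* sumQ f xs ≡ sumQ (λ x → c ℚ.* f x) xs
  *-sumQ c f [] = ℚP.*-zeroʳ c
  *-sumQ c f (x ∷ xs) = trans (ℚP.*-distribˡ-+ c (f x) _) (cong ((c ℚ.* f x) ℚ.+_) (*-sumQ c f xs))

module _ {A B : Set} where

  sumQ-map : (f : B → ℚ) (g : A → B) (xs : List A) → sumQ f (map g xs) ≡ sumQ (f ∘ g) xs
  sumQ-map f g [] = refl
  sumQ-map f g (x ∷ xs) = cong (f (g x) ℚ.+_) (sumQ-map f g xs)

  sumQ-swap : (f : A → B → ℚ) (xs : List A) (ys : List B) →
    sumQ (λ x → sumQ (f x) ys) xs ≡ sumQ (λ y → sumQ (λ x → f x y) xs) ys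
  sumQ-swap f [] ys = sym (sumQ-zero ys (All.tabulate (λ _ → refl)))
  sumQ-swap f (x ∷ xs) ys = trans (cong (sumQ (f x) ys ℚ.+_) (sumQ-swap f xs ys))
                                  (sym (sumQ-+ (f x) (λ y → sumQ (λ x → f x y) xs) ys))

sumQ-concat : {A : Set} (f : A → ℚ) (xss : List (List A)) → sumQ f (concat xss) ≡ sumQ (sumQ f) xss
sumQ-concat f [] = refl
sumQ-concat f (xs ∷ xss) = trans (sumQ-++ f xs (concat xss)) (cong (sumQ f xs ℚ.+_) (sumQ-concat f xss))

sumQ-applyUpTo-single : {A : Set} (f : ℕ → A) (g : A → ℚ) (N j : ℕ) → j < N →
  (∀ i → i ≢ j → g (f i) ≡ 0ℚ) → sumQ g (applyUpTo f N) ≡ g (f j)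
sumQ-applyUpTo-single f g (suc N) zero _ h =
  trans (cong (g (f 0) ℚ.+_) (sumQ-zero {f = g} _ (AllP.applyUpTo⁺₂ (f ∘ suc) N (λ i → h (suc i) (λ ())))))
        (ℚP.+-identityʳ _)
sumQ-applyUpTo-single f g (suc N) (suc j) (s≤s j<N) h =
  trans (cong₂ ℚ._+_ (h 0 (λ ()))
                     (sumQ-applyUpTo-single (f ∘ suc) g N j j<N (λ i i≢j → h (suc i) (i≢j ∘ ℕP.suc-injective))))
        (ℚP.+-identityˡ _)

x*[y*0]≡0 : (a b : ℚ) → a ℚ.* (b ℚ.* 0ℚ) ≡ 0ℚ
x*[y*0]≡0 a b = trans (cong (a ℚ.*_) (ℚP.*-zeroʳ b)) (ℚP.*-zeroʳ a)

infixr 8 𝟙[_]·_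
𝟙[_]·_ : {A : Set} → Dec A → ℚ → ℚ
𝟙[ yes _ ]· c = c
𝟙[ no _ ]· _ = 0ℚ

module _ {A : Set} where

  𝟙-yes : (x : Dec A) → A → (c : ℚ) → 𝟙[ x ]· c ≡ c
  𝟙-yes (yes _) a c = refl
  𝟙-yes (no ¬a) a c = ⊥-elim (¬a a)

  𝟙-no : (x : Dec A) → ¬ A → (c : ℚ) → 𝟙[ x ]· c ≡ 0ℚ
  𝟙-no (yes a) ¬a c = ⊥-elim (¬a a)
  𝟙-no (no _) ¬a c = refl

  𝟙-zero : (x : Dec A) → 𝟙[ x ]· 0ℚ ≡ 0ℚ
  𝟙-zero (yes _) = refl
  𝟙-zero (no _) = refl

  *-𝟙 : (x : Dec A) (a c : ℚ) → a ℚ.* (𝟙[ x ]· c) ≡ 𝟙[ x ]· (a ℚ.* c)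
  *-𝟙 (yes _) a c = refl
  *-𝟙 (no _) a c = ℚP.*-zeroʳ a

  𝟙-+ : (x : Dec A) (a b : ℚ) → (𝟙[ x ]· a) ℚ.+ (𝟙[ x ]· b) ≡ 𝟙[ x ]· (a ℚ.+ b)
  𝟙-+ (yes _) a b = refl
  𝟙-+ (no _) a b = refl

  𝟙-sumQ : {B : Set} (x : Dec A) (f : B → ℚ) (ys : List B) → 𝟙[ x ]· sumQ f ys ≡ sumQ (λ y → 𝟙[ x ]· f y) ys
  𝟙-sumQ (yes _) f ys = refl
  𝟙-sumQ (no _) f ys = sym (sumQ-zero ys (All.tabulate (λ _ → refl)))

  sumQ-filter : {P : A → Set} (P? : (x : A) → Dec (P x)) (f : A → ℚ) (xs : List A) →
    sumQ f (filter P? xs) ≡ sumQ (λ x → 𝟙[ P? x ]· f x) xs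
  sumQ-filter P? f [] = refl
  sumQ-filter P? f (x ∷ xs) with P? x
  ... | yes _ = cong (f x ℚ.+_) (sumQ-filter P? f xs)
  ... | no _ = trans (sumQ-filter P? f xs) (sym (ℚP.+-identityˡ _))

𝟙-cong : {A B : Set} (x : Dec A) (y : Dec B) → (A → B) → (B → A) → {c c′ : ℚ} → (A → c ≡ c′) →
  𝟙[ x ]· c ≡ 𝟙[ y ]· c′
𝟙-cong (yes a) (yes b) f g h = h a
𝟙-cong (yes a) (no ¬b) f g h = ⊥-elim (¬b (f a))
𝟙-cong (no ¬a) (yes b) f g h = ⊥-elim (¬a (g b))
𝟙-cong (no _) (no _) f g h = refl

𝟙-*-𝟙 : {A B C : Set} (x : Dec A) (y : Dec B) (z : Dec C) → (A → B → C) → (C → A × B) →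
  (k r : ℚ) → 𝟙[ x ]· (k ℚ.* (𝟙[ y ]· r)) ≡ 𝟙[ z ]· (k ℚ.* r)
𝟙-*-𝟙 (yes a) (yes b) z to from k r = sym (𝟙-yes z (to a b) _)
𝟙-*-𝟙 (yes a) (no ¬b) z to from k r = trans (ℚP.*-zeroʳ k) (sym (𝟙-no z (¬b ∘ proj₂ ∘ from) _))
𝟙-*-𝟙 (no ¬a) y z to from k r = sym (𝟙-no z (¬a ∘ proj₁ ∘ from) _)

sumQ-range-𝟙 : {a b j : ℕ} → a ≤ j → j ≤ b → (c : ℚ) → sumQ (λ i → 𝟙[ j ℕ.≟ i ]· c) (range a b) ≡ c
sumQ-range-𝟙 {a} {b} {j} a≤j j≤b c = begin
  sumQ (λ i → 𝟙[ j ℕ.≟ i ]· c) (range a b) ≡⟨ sumQ-map _ (a ℕ.+_) (upTo (suc b ∸ a)) ⟩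
  sumQ term (upTo (suc b ∸ a))             ≡⟨ sumQ-applyUpTo-single (λ k → k) term (suc b ∸ a) (j ∸ a) j∸a<N off ⟩
  term (j ∸ a)                             ≡⟨ 𝟙-yes (j ℕ.≟ a ℕ.+ (j ∸ a)) (sym (ℕP.m+[n∸m]≡n a≤j)) c ⟩
  c                                        ∎
  where
  open ≡-Reasoning
  term : ℕ → ℚ
  term k = 𝟙[ j ℕ.≟ a ℕ.+ k ]· c
  j∸a<N : j ∸ a < suc b ∸ a
  j∸a<N = ℕP.∸-monoˡ-< (s≤s j≤b) a≤j
  off : ∀ k → k ≢ j ∸ a → term k ≡ 0ℚ
  off k k≢j∸a = 𝟙-no (j ℕ.≟ a ℕ.+ k) (λ j≡a+k → k≢j∸a (trans (sym (ℕP.m+n∸m≡n a k)) (cong (_∸ a) (sym j≡a+k)))) c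

infixl 6 _+v_ _-v_
_+v_ : ∀ {m} → Vec ℕ m → Vec ℕ m → Vec ℕ m
_+v_ = zipWith ℕ._+_

_-v_ : ∀ {m} → Vec ℕ m → Vec ℕ m → Vec ℕ m
_-v_ = zipWith _∸_

infixr 8 _·v_
_·v_ : ∀ {m} → ℕ → Vec ℕ m → Vec ℕ m
zero ·v u = replicate _ 0
suc k ·v u = u +v k ·v u

+v-∸v : ∀ {m} (a b : Vec ℕ m) → (a +v b) -v a ≡ b
+v-∸v [] [] = refl
+v-∸v (x ∷ a) (y ∷ b) = cong₂ _∷_ (ℕP.m+n∸m≡n x y) (+v-∸v a b)

module _ {m : ℕ} where

  +v-comm : (a b : Vec ℕ m) → a +v b ≡ b +v a
  +v-comm = zipWith-comm ℕP.+-comm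

  +v-assoc : (a b c : Vec ℕ m) → (a +v b) +v c ≡ a +v (b +v c)
  +v-assoc = zipWith-assoc ℕP.+-assoc

  +v-identityˡ : (a : Vec ℕ m) → replicate m 0 +v a ≡ a
  +v-identityˡ = zipWith-identityˡ ℕP.+-identityˡ

  +v-identityʳ : (a : Vec ℕ m) → a +v replicate m 0 ≡ a
  +v-identityʳ = zipWith-identityʳ ℕP.+-identityʳ

  -v-identityʳ : (a : Vec ℕ m) → a -v replicate m 0 ≡ a
  -v-identityʳ = zipWith-identityʳ (λ _ → refl)

  ≡+v⇒∸v : (a b e : Vec ℕ m) → e ≡ a +v b → a +v (e -v a) ≡ e × b ≡ e -v a
  ≡+v⇒∸v a b e refl = cong (a +v_) (+v-∸v a b) , sym (+v-∸v a b)

  ∸v⇒≡+v : (a b e : Vec ℕ m) → a +v (e -v a) ≡ e → b ≡ e -v a → e ≡ a +v b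
  ∸v⇒≡+v a b e h refl = sym h

module _ {m : ℕ} where

  coefM : Mono m → ℚ
  coefM = proj₁

  degM : Mono m → ℕ
  degM x = proj₁ (proj₂ x)

  expM : Mono m → Vec ℕ m
  expM x = proj₂ (proj₂ x)

  IsAt : ℕ → Vec ℕ m → Mono m → Set
  IsAt d e x = degM x ≡ d × expM x ≡ e

  isAt? : (d : ℕ) (e : Vec ℕ m) (x : Mono m) → Dec (IsAt d e x)
  isAt? d e x = (degM x ℕ.≟ d) ×-dec ≡-dec ℕ._≟_ (expM x) e

  coeffM : Mono m → ℕ → Vec ℕ m → ℚ
  coeffM x d e = 𝟙[ isAt? d e x ]· coefM x

  coeff-sumQ : (p : Poly m) (d : ℕ) (e : Vec ℕ m) → coeff p d e ≡ sumQ (λ x → coeffM x d e) p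
  coeff-sumQ p d e = trans (foldr-sumQ coefM (filter (isAt? d e) p)) (sumQ-filter (isAt? d e) coefM p)

  coeff-single : (x : Mono m) (d : ℕ) (e : Vec ℕ m) → coeff (x ∷ []) d e ≡ coeffM x d e
  coeff-single x d e = trans (coeff-sumQ (x ∷ []) d e) (ℚP.+-identityʳ _)

  coeff-++ : (p q : Poly m) (d : ℕ) (e : Vec ℕ m) → coeff (p ++ q) d e ≡ coeff p d e ℚ.+ coeff q d e
  coeff-++ p q d e = begin
    coeff (p ++ q) d e                                          ≡⟨ coeff-sumQ (p ++ q) d e ⟩
    sumQ (λ x → coeffM x d e) (p ++ q)                          ≡⟨ sumQ-++ _ p q ⟩
    sumQ (λ x → coeffM x d e) p ℚ.+ sumQ (λ x → coeffM x d e) q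
      ≡⟨ sym (cong₂ ℚ._+_ (coeff-sumQ p d e) (coeff-sumQ q d e)) ⟩
    coeff p d e ℚ.+ coeff q d e                                 ∎
    where open ≡-Reasoning

  coeff-concatMap : (f : Mono m → Poly m) (p : Poly m) (d : ℕ) (e : Vec ℕ m) →
    coeff (concatMap f p) d e ≡ sumQ (λ x → coeff (f x) d e) p
  coeff-concatMap f p d e = begin
    coeff (concatMap f p) d e                    ≡⟨ coeff-sumQ (concatMap f p) d e ⟩
    sumQ (λ x → coeffM x d e) (concatMap f p)    ≡⟨ sumQ-concat _ (map f p) ⟩
    sumQ (sumQ (λ x → coeffM x d e)) (map f p)   ≡⟨ sumQ-map _ f p ⟩
    sumQ (λ x → sumQ (λ y → coeffM y d e) (f x)) p ≡⟨ sumQ-cong (λ x → sym (coeff-sumQ (f x) d e)) p ⟩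
    sumQ (λ x → coeff (f x) d e) p               ∎
    where open ≡-Reasoning

  coeff-map : (f : Mono m → Mono m) (p : Poly m) (d : ℕ) (e : Vec ℕ m) →
    coeff (map f p) d e ≡ sumQ (λ x → coeffM (f x) d e) p
  coeff-map f p d e = trans (coeff-sumQ (map f p) d e) (sumQ-map _ f p)

  coeff-sumP : (ps : List (Poly m)) (d : ℕ) (e : Vec ℕ m) → coeff (sumP ps) d e ≡ sumQ (λ p → coeff p d e) ps
  coeff-sumP [] d e = refl
  coeff-sumP (p ∷ ps) d e = trans (coeff-++ p (sumP ps) d e) (cong (coeff p d e ℚ.+_) (coeff-sumP ps d e))

  coeff-scaleP : (c : ℚ) (p : Poly m) (d : ℕ) (e : Vec ℕ m) → coeff (scaleP c p) d e ≡ c ℚ.* coeff p d e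
  coeff-scaleP c p d e = begin
    coeff (scaleP c p) d e                       ≡⟨ coeff-sumQ (scaleP c p) d e ⟩
    sumQ (λ x → coeffM x d e) (scaleP c p)       ≡⟨ sumQ-map _ _ p ⟩
    sumQ (λ x → 𝟙[ isAt? d e x ]· (c ℚ.* coefM x)) p ≡⟨ sumQ-cong (λ x → sym (*-𝟙 (isAt? d e x) c (coefM x))) p ⟩
    sumQ (λ x → c ℚ.* coeffM x d e) p            ≡⟨ sym (*-sumQ c _ p) ⟩
    c ℚ.* sumQ (λ x → coeffM x d e) p            ≡⟨ cong (c ℚ.*_) (sym (coeff-sumQ p d e)) ⟩
    c ℚ.* coeff p d e                            ∎
    where open ≡-Reasoning

  coeff-truncP-≤ : (N : ℕ) (p : Poly m) (n : ℕ) (e : Vec ℕ m) → n ≤ N → coeff (truncP N p) n e ≡ coeff p n e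
  coeff-truncP-≤ N p n e n≤N = begin
    coeff (truncP N p) n e                                     ≡⟨ coeff-sumQ (truncP N p) n e ⟩
    sumQ (λ x → coeffM x n e) (truncP N p)                     ≡⟨ sumQ-filter (λ x → degM x ℕ.≤? N) _ p ⟩
    sumQ (λ x → 𝟙[ degM x ℕ.≤? N ]· coeffM x n e) p           ≡⟨ sumQ-cong kept p ⟩
    sumQ (λ x → coeffM x n e) p                                ≡⟨ sym (coeff-sumQ p n e) ⟩
    coeff p n e                                                ∎
    where
    open ≡-Reasoning
    kept : ∀ x → 𝟙[ degM x ℕ.≤? N ]· coeffM x n e ≡ coeffM x n e
    kept x with isAt? n e x
    ... | yes (refl , _) = 𝟙-yes (degM x ℕ.≤? N) n≤N _
    ... | no _ = 𝟙-zero (degM x ℕ.≤? N)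

  coeff-truncP-> : (N : ℕ) (p : Poly m) (n : ℕ) (e : Vec ℕ m) → ¬ n ≤ N → coeff (truncP N p) n e ≡ 0ℚ
  coeff-truncP-> N p n e n≰N = trans (coeff-sumQ (truncP N p) n e)
    (trans (sumQ-filter (λ x → degM x ℕ.≤? N) _ p) (sumQ-zero p (All.tabulate (λ {x} _ → dropped x))))
    where
    dropped : ∀ x → 𝟙[ degM x ℕ.≤? N ]· coeffM x n e ≡ 0ℚ
    dropped x with isAt? n e x
    ... | yes (refl , _) = 𝟙-no (degM x ℕ.≤? N) n≰N _
    ... | no _ = 𝟙-zero (degM x ℕ.≤? N)

  infixl 7 _*M_
  _*M_ : Mono m → Mono m → Mono m
  a *M b = (coefM a ℚ.* coefM b , degM a ℕ.+ degM b , expM a +v expM b)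

  sumQ-*P : (g : Mono m → ℚ) (p q : Poly m) → sumQ g (p *P q) ≡ sumQ (λ a → sumQ (λ b → g (a *M b)) q) p
  sumQ-*P g p q = trans (sumQ-concat g (map (λ a → map (a *M_) q) p))
                   (trans (sumQ-map (sumQ g) (λ a → map (a *M_) q) p)
                          (sumQ-cong (λ a → sumQ-map g (a *M_) q) p))

  coeff-*P : (p q : Poly m) (d : ℕ) (e : Vec ℕ m) →
    coeff (p *P q) d e ≡ sumQ (λ a → sumQ (λ b → coeffM (a *M b) d e) q) p
  coeff-*P p q d e = trans (coeff-sumQ (p *P q) d e) (sumQ-*P (λ x → coeffM x d e) p q)

  -- a ∣ t^d α^e, phrased through the truncated cofactor t^(d ∸ deg a) α^(e -v exp a)
  Divides : Mono m → ℕ → Vec ℕ m → Set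
  Divides a d e = degM a ℕ.+ (d ∸ degM a) ≡ d × expM a +v (e -v expM a) ≡ e

  divides? : (a : Mono m) (d : ℕ) (e : Vec ℕ m) → Dec (Divides a d e)
  divides? a d e = (degM a ℕ.+ (d ∸ degM a) ℕ.≟ d) ×-dec ≡-dec ℕ._≟_ (expM a +v (e -v expM a)) e

  coeffM-*M : (a b : Mono m) (d : ℕ) (e : Vec ℕ m) →
    coeffM (a *M b) d e ≡ 𝟙[ divides? a d e ]· (coefM a ℚ.* coeffM b (d ∸ degM a) (e -v expM a))
  coeffM-*M a b d e with isAt? d e (a *M b) | divides? a d e | isAt? (d ∸ degM a) (e -v expM a) b
  ... | yes _ | yes _ | yes _ = refl
  ... | yes (refl , refl) | no ¬div | _ =
    ⊥-elim (¬div (cong (degM a ℕ.+_) (ℕP.m+n∸m≡n (degM a) (degM b)) , cong (expM a +v_) (+v-∸v (expM a) (expM b))))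
  ... | yes (refl , refl) | yes _ | no ¬at =
    ⊥-elim (¬at (sym (ℕP.m+n∸m≡n (degM a) (degM b)) , sym (+v-∸v (expM a) (expM b))))
  ... | no ¬at | yes (div₁ , div₂) | yes (at₁ , at₂) =
    ⊥-elim (¬at (trans (cong (degM a ℕ.+_) at₁) div₁ , trans (cong (expM a +v_) at₂) div₂))
  ... | no _ | yes _ | no _ = sym (ℚP.*-zeroʳ (coefM a))
  ... | no _ | no _ | _ = refl

  coeff-*P-divides : (p q : Poly m) (d : ℕ) (e : Vec ℕ m) →
    coeff (p *P q) d e ≡ sumQ (λ a → 𝟙[ divides? a d e ]· (coefM a ℚ.* coeff q (d ∸ degM a) (e -v expM a))) p
  coeff-*P-divides p q d e = trans (coeff-*P p q d e) (sumQ-cong inner p)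
    where
    open ≡-Reasoning
    inner : ∀ a → sumQ (λ b → coeffM (a *M b) d e) q
                ≡ 𝟙[ divides? a d e ]· (coefM a ℚ.* coeff q (d ∸ degM a) (e -v expM a))
    inner a = begin
      sumQ (λ b → coeffM (a *M b) d e) q
        ≡⟨ sumQ-cong (λ b → coeffM-*M a b d e) q ⟩
      sumQ (λ b → 𝟙[ D ]· (coefM a ℚ.* coeffM b d′ e′)) q
        ≡⟨ sym (𝟙-sumQ D _ q) ⟩
      𝟙[ D ]· sumQ (λ b → coefM a ℚ.* coeffM b d′ e′) q
        ≡⟨ cong (𝟙[ D ]·_) (sym (*-sumQ (coefM a) _ q)) ⟩
      𝟙[ D ]· (coefM a ℚ.* sumQ (λ b → coeffM b d′ e′) q)
        ≡⟨ cong (λ z → 𝟙[ D ]· (coefM a ℚ.* z)) (sym (coeff-sumQ q d′ e′)) ⟩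
      𝟙[ D ]· (coefM a ℚ.* coeff q d′ e′) ∎
      where
      D = divides? a d e
      d′ = d ∸ degM a
      e′ = e -v expM a

  coeff-single-*P : (x : Mono m) (q : Poly m) (d : ℕ) (e : Vec ℕ m) →
    coeff ((x ∷ []) *P q) d e ≡ 𝟙[ divides? x d e ]· (coefM x ℚ.* coeff q (d ∸ degM x) (e -v expM x))
  coeff-single-*P x q d e = trans (coeff-*P-divides (x ∷ []) q d e) (ℚP.+-identityʳ _)

module _ {m : ℕ} where

  infix 4 _≈_
  record _≈_ (p q : Poly m) : Set where
    constructor mk≈
    field at : ∀ d e → coeff p d e ≡ coeff q d e
  open _≈_ public

  ≈-refl : {p : Poly m} → p ≈ p
  ≈-refl = mk≈ λ d e → refl

  ≈-sym : {p q : Poly m} → p ≈ q → q ≈ p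
  ≈-sym h = mk≈ λ d e → sym (at h d e)

  ≈-trans : {p q r : Poly m} → p ≈ q → q ≈ r → p ≈ r
  ≈-trans h k = mk≈ λ d e → trans (at h d e) (at k d e)

  ≈-setoid : Setoid 0ℓ 0ℓ
  ≈-setoid = record
    { Carrier = Poly m ; _≈_ = _≈_
    ; isEquivalence = record { refl = ≈-refl ; sym = ≈-sym ; trans = ≈-trans } }

  module ≈-Reasoning = SetoidReasoning ≈-setoid

  +P-cong : {p p′ q q′ : Poly m} → p ≈ p′ → q ≈ q′ → p +P q ≈ p′ +P q′
  +P-cong {p} {p′} {q} {q′} h k = mk≈ λ d e →
    trans (coeff-++ p q d e) (trans (cong₂ ℚ._+_ (at h d e) (at k d e)) (sym (coeff-++ p′ q′ d e)))

  scaleP-cong : (c : ℚ) {p q : Poly m} → p ≈ q → scaleP c p ≈ scaleP c q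
  scaleP-cong c {p} {q} h = mk≈ λ d e →
    trans (coeff-scaleP c p d e) (trans (cong (c ℚ.*_) (at h d e)) (sym (coeff-scaleP c q d e)))

  scaleP-scaleP : (a b : ℚ) (p : Poly m) → scaleP a (scaleP b p) ≈ scaleP (a ℚ.* b) p
  scaleP-scaleP a b p = mk≈ λ d e → begin
    coeff (scaleP a (scaleP b p)) d e ≡⟨ coeff-scaleP a (scaleP b p) d e ⟩
    a ℚ.* coeff (scaleP b p) d e       ≡⟨ cong (a ℚ.*_) (coeff-scaleP b p d e) ⟩
    a ℚ.* (b ℚ.* coeff p d e)          ≡⟨ sym (ℚP.*-assoc a b _) ⟩
    (a ℚ.* b) ℚ.* coeff p d e          ≡⟨ sym (coeff-scaleP (a ℚ.* b) p d e) ⟩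
    coeff (scaleP (a ℚ.* b) p) d e     ∎
    where open ≡-Reasoning

  *M-comm : (a b : Mono m) → a *M b ≡ b *M a
  *M-comm a b = cong₂ _,_ (ℚP.*-comm (coefM a) (coefM b))
                          (cong₂ _,_ (ℕP.+-comm (degM a) (degM b)) (+v-comm (expM a) (expM b)))

  *M-assoc : (a b c : Mono m) → (a *M b) *M c ≡ a *M (b *M c)
  *M-assoc a b c = cong₂ _,_ (ℚP.*-assoc (coefM a) (coefM b) (coefM c))
                             (cong₂ _,_ (ℕP.+-assoc (degM a) (degM b) (degM c)) (+v-assoc (expM a) (expM b) (expM c)))

  *P-comm : (p q : Poly m) → p *P q ≈ q *P p
  *P-comm p q = mk≈ λ d e → begin
    coeff (p *P q) d e                              ≡⟨ coeff-*P p q d e ⟩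
    sumQ (λ a → sumQ (λ b → coeffM (a *M b) d e) q) p
      ≡⟨ sumQ-cong (λ a → sumQ-cong (λ b → cong (λ z → coeffM z d e) (*M-comm a b)) q) p ⟩
    sumQ (λ a → sumQ (λ b → coeffM (b *M a) d e) q) p ≡⟨ sumQ-swap (λ a b → coeffM (b *M a) d e) p q ⟩
    sumQ (λ b → sumQ (λ a → coeffM (b *M a) d e) p) q ≡⟨ sym (coeff-*P q p d e) ⟩
    coeff (q *P p) d e                              ∎
    where open ≡-Reasoning

  *P-congʳ : (p : Poly m) {q q′ : Poly m} → q ≈ q′ → p *P q ≈ p *P q′
  *P-congʳ p {q} {q′} h = mk≈ λ d e → begin
    coeff (p *P q) d e  ≡⟨ coeff-*P-divides p q d e ⟩
    sumQ (λ a → 𝟙[ divides? a d e ]· (coefM a ℚ.* coeff q (d ∸ degM a) (e -v expM a))) p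
      ≡⟨ sumQ-cong (λ a → cong (λ z → 𝟙[ divides? a d e ]· (coefM a ℚ.* z)) (at h _ _)) p ⟩
    sumQ (λ a → 𝟙[ divides? a d e ]· (coefM a ℚ.* coeff q′ (d ∸ degM a) (e -v expM a))) p
      ≡⟨ sym (coeff-*P-divides p q′ d e) ⟩
    coeff (p *P q′) d e ∎
    where open ≡-Reasoning

  *P-congˡ : {p p′ : Poly m} (q : Poly m) → p ≈ p′ → p *P q ≈ p′ *P q
  *P-congˡ {p} {p′} q h = ≈-trans (*P-comm p q) (≈-trans (*P-congʳ q h) (*P-comm q p′))

  *P-cong : {p p′ q q′ : Poly m} → p ≈ p′ → q ≈ q′ → p *P q ≈ p′ *P q′
  *P-cong {p} {p′} {q} {q′} h k = ≈-trans (*P-congˡ q h) (*P-congʳ p′ k)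

  *P-assoc : (p q r : Poly m) → (p *P q) *P r ≈ p *P (q *P r)
  *P-assoc p q r = mk≈ λ d e → begin
    coeff ((p *P q) *P r) d e                             ≡⟨ coeff-*P (p *P q) r d e ⟩
    sumQ (λ x → sumQ (λ c → coeffM (x *M c) d e) r) (p *P q) ≡⟨ sumQ-*P _ p q ⟩
    sumQ (λ a → sumQ (λ b → sumQ (λ c → coeffM ((a *M b) *M c) d e) r) q) p
      ≡⟨ sumQ-cong (λ a → sumQ-cong (λ b → sumQ-cong (λ c →
           cong (λ z → coeffM z d e) (*M-assoc a b c)) r) q) p ⟩
    sumQ (λ a → sumQ (λ b → sumQ (λ c → coeffM (a *M (b *M c)) d e) r) q) p
      ≡⟨ sumQ-cong (λ a → sym (sumQ-*P (λ y → coeffM (a *M y) d e) q r)) p ⟩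
    sumQ (λ a → sumQ (λ y → coeffM (a *M y) d e) (q *P r)) p ≡⟨ sym (coeff-*P p (q *P r) d e) ⟩
    coeff (p *P (q *P r)) d e                             ∎
    where open ≡-Reasoning

  *P-distribʳ : (p q r : Poly m) → (p +P q) *P r ≈ (p *P r) +P (q *P r)
  *P-distribʳ p q r = mk≈ λ d e → begin
    coeff ((p +P q) *P r) d e                            ≡⟨ coeff-*P (p +P q) r d e ⟩
    sumQ (λ a → sumQ (λ b → coeffM (a *M b) d e) r) (p ++ q) ≡⟨ sumQ-++ _ p q ⟩
    _
      ≡⟨ cong₂ ℚ._+_ (sym (coeff-*P p r d e)) (sym (coeff-*P q r d e)) ⟩
    coeff (p *P r) d e ℚ.+ coeff (q *P r) d e            ≡⟨ sym (coeff-++ (p *P r) (q *P r) d e) ⟩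
    coeff ((p *P r) +P (q *P r)) d e                     ∎
    where open ≡-Reasoning

  scaleP-*Pˡ : (c : ℚ) (p q : Poly m) → scaleP c p *P q ≈ scaleP c (p *P q)
  scaleP-*Pˡ c p q = mk≈ λ d e → begin
    coeff (scaleP c p *P q) d e ≡⟨ coeff-*P (scaleP c p) q d e ⟩
    sumQ (λ a → sumQ (λ b → coeffM (a *M b) d e) q) (scaleP c p) ≡⟨ sumQ-map _ _ p ⟩
    sumQ (λ a → sumQ (λ b → 𝟙[ isAt? d e (a *M b) ]· ((c ℚ.* coefM a) ℚ.* coefM b)) q) p
      ≡⟨ sumQ-cong (λ a → sumQ-cong (λ b → pull a b d e) q) p ⟩
    sumQ (λ a → sumQ (λ b → c ℚ.* coeffM (a *M b) d e) q) p ≡⟨ sumQ-cong (λ a → sym (*-sumQ c _ q)) p ⟩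
    sumQ (λ a → c ℚ.* sumQ (λ b → coeffM (a *M b) d e) q) p ≡⟨ sym (*-sumQ c _ p) ⟩
    c ℚ.* sumQ (λ a → sumQ (λ b → coeffM (a *M b) d e) q) p ≡⟨ cong (c ℚ.*_) (sym (coeff-*P p q d e)) ⟩
    c ℚ.* coeff (p *P q) d e                                 ≡⟨ sym (coeff-scaleP c (p *P q) d e) ⟩
    coeff (scaleP c (p *P q)) d e ∎
    where
    open ≡-Reasoning
    pull : ∀ a b d e → 𝟙[ isAt? d e (a *M b) ]· ((c ℚ.* coefM a) ℚ.* coefM b) ≡ c ℚ.* coeffM (a *M b) d e
    pull a b d e = trans (cong (𝟙[ isAt? d e (a *M b) ]·_) (ℚP.*-assoc c (coefM a) (coefM b)))
                     (sym (*-𝟙 (isAt? d e (a *M b)) c _))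

  scaleP-*Pʳ : (c : ℚ) (p q : Poly m) → p *P scaleP c q ≈ scaleP c (p *P q)
  scaleP-*Pʳ c p q =
    ≈-trans (*P-comm p (scaleP c q)) (≈-trans (scaleP-*Pˡ c q p) (scaleP-cong c (*P-comm q p)))

  *P-identityˡ : (p : Poly m) → constP 1ℚ *P p ≈ p
  *P-identityˡ p = mk≈ λ d e → begin
    coeff (constP 1ℚ *P p) d e ≡⟨ coeff-*P (constP 1ℚ) p d e ⟩
    sumQ (λ b → coeffM ((1ℚ , 0 , replicate m 0) *M b) d e) p ℚ.+ 0ℚ ≡⟨ ℚP.+-identityʳ _ ⟩
    sumQ (λ b → coeffM ((1ℚ , 0 , replicate m 0) *M b) d e) p
      ≡⟨ sumQ-cong (λ b → cong (λ z → coeffM z d e)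
           (cong₂ _,_ (ℚP.*-identityˡ (coefM b)) (cong (degM b ,_) (+v-identityˡ (expM b))))) p ⟩
    sumQ (λ b → coeffM b d e) p ≡⟨ sym (coeff-sumQ p d e) ⟩
    coeff p d e ∎
    where open ≡-Reasoning

  *P-identityʳ : (p : Poly m) → p *P constP 1ℚ ≈ p
  *P-identityʳ p = ≈-trans (*P-comm p (constP 1ℚ)) (*P-identityˡ p)

  ^P-cong : {p q : Poly m} → p ≈ q → (k : ℕ) → p ^P k ≈ q ^P k
  ^P-cong h zero = ≈-refl
  ^P-cong h (suc k) = *P-cong h (^P-cong h k)

  ^P-+ : (p : Poly m) (i j : ℕ) → p ^P (i ℕ.+ j) ≈ (p ^P i) *P (p ^P j)
  ^P-+ p zero j = ≈-sym (*P-identityˡ (p ^P j))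
  ^P-+ p (suc i) j = ≈-trans (*P-congʳ p (^P-+ p i j)) (≈-sym (*P-assoc p (p ^P i) (p ^P j)))

  *P-interchange : (a b c d : Poly m) → (a *P b) *P (c *P d) ≈ (a *P c) *P (b *P d)
  *P-interchange a b c d =
    ≈-trans (*P-assoc a b (c *P d)) (≈-trans (*P-congʳ a (≈-sym (*P-assoc b c d)))
    (≈-trans (*P-congʳ a (*P-congˡ d (*P-comm b c))) (≈-trans (*P-congʳ a (*P-assoc c b d))
    (≈-sym (*P-assoc a c (b *P d))))))

  coeff-concatMap-*P : (f : Mono m → Poly m) (p r : Poly m) (d : ℕ) (e : Vec ℕ m) →
    coeff (concatMap f p *P r) d e ≡ sumQ (λ x → coeff (f x *P r) d e) p
  coeff-concatMap-*P f [] r d e = refl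
  coeff-concatMap-*P f (x ∷ p) r d e =
    trans (at (*P-distribʳ (f x) (concatMap f p) r) d e)
          (trans (coeff-++ (f x *P r) _ d e) (cong (coeff (f x *P r) d e ℚ.+_) (coeff-concatMap-*P f p r d e)))

  coeff-*P-concatMap : (f : Mono m → Poly m) (r q : Poly m) (d : ℕ) (e : Vec ℕ m) →
    coeff (r *P concatMap f q) d e ≡ sumQ (λ y → coeff (r *P f y) d e) q
  coeff-*P-concatMap f r q d e = trans (at (*P-comm r (concatMap f q)) d e)
    (trans (coeff-concatMap-*P f q r d e) (sumQ-cong (λ y → at (*P-comm (f y) r) d e) q))

  coeff-*P-map : (f : Mono m → Mono m) (r q : Poly m) (d : ℕ) (e : Vec ℕ m) →
    coeff (r *P map f q) d e ≡ sumQ (λ y → coeff (r *P (f y ∷ [])) d e) q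
  coeff-*P-map f r q d e = begin
    coeff (r *P map f q) d e                       ≡⟨ cong (λ z → coeff (r *P z) d e) map≡concatMap ⟩
    coeff (r *P concatMap (λ y → f y ∷ []) q) d e  ≡⟨ coeff-*P-concatMap (λ y → f y ∷ []) r q d e ⟩
    sumQ (λ y → coeff (r *P (f y ∷ [])) d e) q     ∎
    where
    open ≡-Reasoning
    map≡concatMap : map f q ≡ concatMap (λ y → f y ∷ []) q
    map≡concatMap = trans (sym (concatMap-pure (map f q))) (concatMap-map (_∷ []) f q)

  coeff-sumP-*P : (ps : List (Poly m)) (q : Poly m) (d : ℕ) (e : Vec ℕ m) →
    coeff (sumP ps *P q) d e ≡ sumQ (λ p → coeff (p *P q) d e) ps
  coeff-sumP-*P [] q d e = refl
  coeff-sumP-*P (p ∷ ps) q d e = trans (at (*P-distribʳ p (sumP ps) q) d e)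
    (trans (coeff-++ (p *P q) _ d e) (cong (coeff (p *P q) d e ℚ.+_) (coeff-sumP-*P ps q d e)))

-- z / 1 normalises through gcd and is stuck for a variable z; its canonical form lets + and * compute.
z/1≡mkℚ : (z : ℤ) → z ℚ./ 1 ≡ ℚ.mkℚ z 0 (Coprime.sym (Coprime.1-coprimeTo _))
z/1≡mkℚ z = canonical (z ℚ./ 1) numerator denominator
  where
  canonical : (q : ℚ) → ℚ.numerator q ≡ z → ℚ.denominator q ≡ + 1 →
              q ≡ ℚ.mkℚ z 0 (Coprime.sym (Coprime.1-coprimeTo _))
  canonical (ℚ.mkℚ _ _ _) refl refl = refl
  numerator : ℚ.numerator (z ℚ./ 1) ≡ z
  numerator = trans (sym (ℤP.*-identityʳ _))
    (trans (cong (ℚ.numerator (z ℚ./ 1) ℤ.*_) (sym (ℤG.gcd-zeroʳ z))) (ℚP.↥-/ z 1))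
  denominator : ℚ.denominator (z ℚ./ 1) ≡ + 1
  denominator = trans (sym (ℤP.*-identityʳ _))
    (trans (cong (ℚ.denominator (z ℚ./ 1) ℤ.*_) (sym (ℤG.gcd-zeroʳ z))) (ℚP.↧-/ z 1))

1/[1+k]≡mkℚ : (k : ℕ) → (+ 1) ℚ./ suc k ≡ ℚ.mkℚ (+ 1) k (Coprime.1-coprimeTo _)
1/[1+k]≡mkℚ k = canonical ((+ 1) ℚ./ suc k) numerator denominator
  where
  canonical : (q : ℚ) → ℚ.numerator q ≡ + 1 → ℚ.denominator q ≡ + suc k →
              q ≡ ℚ.mkℚ (+ 1) k (Coprime.1-coprimeTo _)
  canonical (ℚ.mkℚ _ _ _) refl refl = refl
  numerator : ℚ.numerator ((+ 1) ℚ./ suc k) ≡ + 1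
  numerator = trans (sym (ℤP.*-identityʳ _))
    (trans (cong (ℚ.numerator ((+ 1) ℚ./ suc k) ℤ.*_) (sym (ℤG.gcd-zeroˡ (+ suc k)))) (ℚP.↥-/ (+ 1) (suc k)))
  denominator : ℚ.denominator ((+ 1) ℚ./ suc k) ≡ + suc k
  denominator = trans (sym (ℤP.*-identityʳ _))
    (trans (cong (ℚ.denominator ((+ 1) ℚ./ suc k) ℤ.*_) (sym (ℤG.gcd-zeroˡ (+ suc k)))) (ℚP.↧-/ (+ 1) (suc k)))

/1-+ : (a b : ℤ) → (a ℚ./ 1) ℚ.+ (b ℚ./ 1) ≡ (a ℤ.+ b) ℚ./ 1
/1-+ a b rewrite z/1≡mkℚ a | z/1≡mkℚ b = cong (ℚ._/ 1) (cong₂ ℤ._+_ (ℤP.*-identityʳ a) (ℤP.*-identityʳ b))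

/1-* : (a b : ℤ) → (a ℚ./ 1) ℚ.* (b ℚ./ 1) ≡ (a ℤ.* b) ℚ./ 1
/1-* a b rewrite z/1≡mkℚ a | z/1≡mkℚ b = refl

1/n*n≡1 : (n : ℕ) .{{_ : ℕ.NonZero n}} → ((+ 1) ℚ./ n) ℚ.* ((+ n) ℚ./ 1) ≡ 1ℚ
1/n*n≡1 (suc k) = trans (cong₂ ℚ._*_ (1/[1+k]≡mkℚ k) (z/1≡mkℚ (+ suc k)))
                         (ℚP.*-inverseˡ (ℚ.mkℚ (+ suc k) 0 (Coprime.sym (Coprime.1-coprimeTo _))))

invFact*fact≡1 : (n : ℕ) → invFact n ℚ.* fact n ≡ 1ℚ
invFact*fact≡1 n = 1/n*n≡1 (n !) {{ℕP._!≢0 n}}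

isInteger-+ : {a b : ℚ} → IsInteger a → IsInteger b → IsInteger (a ℚ.+ b)
isInteger-+ (z , refl) (w , refl) = z ℤ.+ w , /1-+ z w

isInteger-* : {a b : ℚ} → IsInteger a → IsInteger b → IsInteger (a ℚ.* b)
isInteger-* (z , refl) (w , refl) = z ℤ.* w , /1-* z w

isInteger-0 : IsInteger 0ℚ
isInteger-0 = + 0 , refl

isInteger-1 : IsInteger 1ℚ
isInteger-1 = + 1 , refl

isInteger-−1 : IsInteger (ℚ.- 1ℚ)
isInteger-−1 = ℤ.- (+ 1) , refl

isInteger-cong : {a b : ℚ} → a ≡ b → IsInteger a → IsInteger b
isInteger-cong refl h = h

isInteger-𝟙 : {A : Set} (x : Dec A) {c : ℚ} → IsInteger c → IsInteger (𝟙[ x ]· c)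
isInteger-𝟙 (yes _) h = h
isInteger-𝟙 (no _) h = isInteger-0

isInteger-sumQ : {A : Set} (f : A → ℚ) (xs : List A) → All (IsInteger ∘ f) xs → IsInteger (sumQ f xs)
isInteger-sumQ f [] [] = isInteger-0
isInteger-sumQ f (x ∷ xs) (h ∷ hs) = isInteger-+ h (isInteger-sumQ f xs hs)

isInteger-invFact*fact : {n i : ℕ} → n ≤ i → IsInteger (invFact n ℚ.* fact i)
isInteger-invFact*fact {n} {i} n≤i with m≤n⇒m!∣n! n≤i
... | divides q i!≡q*n! = + q , (begin
  invFact n ℚ.* fact i                                ≡⟨ cong (λ z → invFact n ℚ.* ((+ z) ℚ./ 1)) i!≡q*n! ⟩
  invFact n ℚ.* ((+ (q ℕ.* n !)) ℚ./ 1)               ≡⟨ cong (λ z → invFact n ℚ.* (z ℚ./ 1)) n!*q ⟩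
  invFact n ℚ.* (((+ (n !)) ℤ.* (+ q)) ℚ./ 1)         ≡⟨ cong (invFact n ℚ.*_) (sym (/1-* (+ (n !)) (+ q))) ⟩
  invFact n ℚ.* (fact n ℚ.* ((+ q) ℚ./ 1))            ≡⟨ sym (ℚP.*-assoc (invFact n) (fact n) _) ⟩
  (invFact n ℚ.* fact n) ℚ.* ((+ q) ℚ./ 1)            ≡⟨ cong (ℚ._* ((+ q) ℚ./ 1)) (invFact*fact≡1 n) ⟩
  1ℚ ℚ.* ((+ q) ℚ./ 1)                                ≡⟨ ℚP.*-identityˡ _ ⟩
  (+ q) ℚ./ 1                                         ∎)
  where
  open ≡-Reasoning
  n!*q : + (q ℕ.* n !) ≡ (+ (n !)) ℤ.* (+ q)
  n!*q = trans (cong +_ (ℕP.*-comm q (n !))) (ℤP.pos-* (n !) q)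

choose : ℕ → ℕ → ℚ
choose i s = (+ (i C s)) ℚ./ 1

choose-pascal : (i s : ℕ) → choose i s ℚ.+ choose i (suc s) ≡ choose (suc i) (suc s)
choose-pascal i s = trans (/1-+ (+ (i C s)) (+ (i C suc s))) (cong (λ z → (+ z) ℚ./ 1) (nCk+nC[k+1]≡[n+1]C[k+1] i s))

choose-> : (i s : ℕ) → i < s → choose i s ≡ 0ℚ
choose-> i s i<s = cong (λ z → (+ z) ℚ./ 1) (k>n⇒nCk≡0 i<s)

fact≡choose*fact*fact : {i s : ℕ} → s ≤ i → fact i ≡ (choose i s ℚ.* fact s) ℚ.* fact (i ∸ s)
fact≡choose*fact*fact {i} {s} s≤i = begin
  fact i                                                   ≡⟨ cong (λ z → (+ z) ℚ./ 1) (sym i!≡C*s!*[i∸s]!) ⟩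
  (+ (((i C s) ℕ.* s !) ℕ.* (i ∸ s) !)) ℚ./ 1              ≡⟨ cong (ℚ._/ 1) (ℤP.pos-* ((i C s) ℕ.* s !) ((i ∸ s) !)) ⟩
  ((+ ((i C s) ℕ.* s !)) ℤ.* (+ ((i ∸ s) !))) ℚ./ 1        ≡⟨ sym (/1-* (+ ((i C s) ℕ.* s !)) (+ ((i ∸ s) !))) ⟩
  ((+ ((i C s) ℕ.* s !)) ℚ./ 1) ℚ.* fact (i ∸ s)
    ≡⟨ cong (λ z → (z ℚ./ 1) ℚ.* fact (i ∸ s)) (ℤP.pos-* (i C s) (s !)) ⟩
  (((+ (i C s)) ℤ.* (+ (s !))) ℚ./ 1) ℚ.* fact (i ∸ s)
    ≡⟨ cong (ℚ._* fact (i ∸ s)) (sym (/1-* (+ (i C s)) (+ (s !)))) ⟩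
  (choose i s ℚ.* fact s) ℚ.* fact (i ∸ s)                 ∎
  where
  open ≡-Reasoning
  instance _ = ℕP.m*n≢0 (s !) ((i ∸ s) !) {{ℕP._!≢0 s}} {{ℕP._!≢0 (i ∸ s)}}
  i!≡C*s!*[i∸s]! : ((i C s) ℕ.* s !) ℕ.* (i ∸ s) ! ≡ i !
  i!≡C*s!*[i∸s]! = trans (ℕP.*-assoc (i C s) (s !) _)
                         (trans (cong (ℕ._* (s ! ℕ.* (i ∸ s) !)) (nCk≡n!/k![n-k]! s≤i)) (m/n*n≡m (k![n∸k]!∣n! s≤i)))

invFact*fact≡fact*choose : {i s : ℕ} → s ≤ i → (c : ℚ) →
  invFact (i ∸ s) ℚ.* (c ℚ.* fact i) ≡ fact s ℚ.* (c ℚ.* choose i s)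
invFact*fact≡fact*choose {i} {s} s≤i c = begin
  invFact j ℚ.* (c ℚ.* fact i)
    ≡⟨ cong (λ z → invFact j ℚ.* (c ℚ.* z)) (fact≡choose*fact*fact s≤i) ⟩
  invFact j ℚ.* (c ℚ.* ((choose i s ℚ.* fact s) ℚ.* fact j)) ≡⟨ regroup (invFact j) (fact j) c (choose i s) (fact s) ⟩
  (invFact j ℚ.* fact j) ℚ.* (fact s ℚ.* (c ℚ.* choose i s))
    ≡⟨ cong (ℚ._* (fact s ℚ.* (c ℚ.* choose i s))) (invFact*fact≡1 j) ⟩
  1ℚ ℚ.* (fact s ℚ.* (c ℚ.* choose i s))                    ≡⟨ ℚP.*-identityˡ _ ⟩
  fact s ℚ.* (c ℚ.* choose i s)                             ∎
  where
  open ≡-Reasoning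
  open +-*-Solver
  j = i ∸ s
  regroup : ∀ I F c C S → I ℚ.* (c ℚ.* ((C ℚ.* S) ℚ.* F)) ≡ (I ℚ.* F) ℚ.* (S ℚ.* (c ℚ.* C))
  regroup = solve 5 (λ I F c C S → I :* (c :* ((C :* S) :* F)) := (I :* F) :* (S :* (c :* C))) refl

module _ {m : ℕ} where

  IntegralTerms : Poly m → Set
  IntegralTerms = All (IsInteger ∘ coefM)

  integralTerms⇒InZPoly : {p : Poly m} → IntegralTerms p → InZPoly p
  integralTerms⇒InZPoly {p} h d e = isInteger-cong (sym (coeff-sumQ p d e))
    (isInteger-sumQ _ p (All.map (λ {x} → isInteger-𝟙 (isAt? d e x)) h))

  InZPoly-≈ : {p q : Poly m} → p ≈ q → InZPoly p → InZPoly q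
  InZPoly-≈ p≈q h d e = isInteger-cong (at p≈q d e) (h d e)

  integralTerms-+P : {p q : Poly m} → IntegralTerms p → IntegralTerms q → IntegralTerms (p +P q)
  integralTerms-+P = AllP.++⁺

  integralTerms-scaleP : {c : ℚ} {p : Poly m} → IsInteger c → IntegralTerms p → IntegralTerms (scaleP c p)
  integralTerms-scaleP hc hp = AllP.map⁺ (All.map (isInteger-* hc) hp)

  integralTerms-*P : {p q : Poly m} → IntegralTerms p → IntegralTerms q → IntegralTerms (p *P q)
  integralTerms-*P [] hq = []
  integralTerms-*P (hx ∷ hp) hq = AllP.++⁺ (AllP.map⁺ (All.map (isInteger-* hx) hq)) (integralTerms-*P hp hq)

  integralTerms-^P : {p : Poly m} → IntegralTerms p → (k : ℕ) → IntegralTerms (p ^P k)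
  integralTerms-^P hp zero = isInteger-1 ∷ []
  integralTerms-^P hp (suc k) = integralTerms-*P hp (integralTerms-^P hp k)

  integralTerms-tP : IntegralTerms (tP {m})
  integralTerms-tP = isInteger-1 ∷ []

  integralTerms-alpha : (j : Fin (suc m)) → IntegralTerms (alpha j)
  integralTerms-alpha zero = []
  integralTerms-alpha (suc k) = isInteger-1 ∷ []

module _ {m : ℕ} where

  ≡⇒≈ : {p q : Poly m} → p ≡ q → p ≈ q
  ≡⇒≈ refl = ≈-refl

  shiftM : Poly m → Mono m → Poly m
  shiftM a x = scaleP (coefM x) (((tP +P a) ^P degM x) *P ((1ℚ , 0 , expM x) ∷ []))

  shift : Poly m → Poly m → Poly m
  shift a = concatMap (shiftM a)

  shift-+P : (a p q : Poly m) → shift a (p +P q) ≈ shift a p +P shift a q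
  shift-+P a p q = ≡⇒≈ (trans (cong List.concat (map-++ (shiftM a) p q)) (sym (concat-++ (map (shiftM a) p) _)))

  shiftM-*M : (a : Poly m) (x y : Mono m) → shiftM a (x *M y) ≈ shiftM a x *P shiftM a y
  shiftM-*M a x y = ≈-sym (begin
    scaleP (coefM x) X *P scaleP (coefM y) Y          ≈⟨ scaleP-*Pˡ (coefM x) X (scaleP (coefM y) Y) ⟩
    scaleP (coefM x) (X *P scaleP (coefM y) Y)        ≈⟨ scaleP-cong (coefM x) (scaleP-*Pʳ (coefM y) X Y) ⟩
    scaleP (coefM x) (scaleP (coefM y) (X *P Y))      ≈⟨ scaleP-scaleP (coefM x) (coefM y) (X *P Y) ⟩
    scaleP (coefM x ℚ.* coefM y) (X *P Y)
      ≈⟨ scaleP-cong (coefM x ℚ.* coefM y) (*P-interchange (W ^P degM x) (Eˣ x) (W ^P degM y) (Eˣ y)) ⟩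
    scaleP (coefM x ℚ.* coefM y) (((W ^P degM x) *P (W ^P degM y)) *P (Eˣ x *P Eˣ y))
      ≈⟨ scaleP-cong (coefM x ℚ.* coefM y) (*P-cong (≈-sym (^P-+ W (degM x) (degM y)))
                                (≡⇒≈ (cong (λ c → (c , 0 , expM x +v expM y) ∷ []) (ℚP.*-identityˡ 1ℚ)))) ⟩
    shiftM a (x *M y) ∎)
    where
    open ≈-Reasoning
    W = tP +P a
    Eˣ : Mono m → Poly m
    Eˣ z = (1ℚ , 0 , expM z) ∷ []
    X = (W ^P degM x) *P Eˣ x
    Y = (W ^P degM y) *P Eˣ y

  shift-*P : (a p q : Poly m) → shift a (p *P q) ≈ shift a p *P shift a q
  shift-*P a p q = mk≈ λ d e → begin
    coeff (shift a (p *P q)) d e                                   ≡⟨ coeff-concatMap (shiftM a) (p *P q) d e ⟩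
    sumQ (λ z → coeff (shiftM a z) d e) (p *P q)                   ≡⟨ sumQ-*P _ p q ⟩
    sumQ (λ x → sumQ (λ y → coeff (shiftM a (x *M y)) d e) q) p
      ≡⟨ sumQ-cong (λ x → sumQ-cong (λ y → at (shiftM-*M a x y) d e) q) p ⟩
    sumQ (λ x → sumQ (λ y → coeff (shiftM a x *P shiftM a y) d e) q) p
      ≡⟨ sumQ-cong (λ x → sym (coeff-*P-concatMap (shiftM a) (shiftM a x) q d e)) p ⟩
    sumQ (λ x → coeff (shiftM a x *P shift a q) d e) p
      ≡⟨ sym (coeff-concatMap-*P (shiftM a) p (shift a q) d e) ⟩
    coeff (shift a p *P shift a q) d e                             ∎
    where open ≡-Reasoning

  shift-const : (a : Poly m) (c : ℚ) (u : Vec ℕ m) → shift a ((c , 0 , u) ∷ []) ≈ (c , 0 , u) ∷ []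
  shift-const a c u = ≡⇒≈ (cong₂ (λ c′ u′ → (c′ , 0 , u′) ∷ []) (ℚP.*-identityʳ c) (+v-identityˡ u))

  shift-^P : (a p : Poly m) (k : ℕ) → shift a (p ^P k) ≈ shift a p ^P k
  shift-^P a p zero = shift-const a 1ℚ (replicate m 0)
  shift-^P a p (suc k) = ≈-trans (shift-*P a p (p ^P k)) (*P-congʳ (shift a p) (shift-^P a p k))

  shift-negP-tP : (a : Poly m) → shift a (negP tP) ≈ scaleP (ℚ.- 1ℚ) (tP +P a)
  shift-negP-tP a = begin
    scaleP (ℚ.- 1ℚ ℚ.* 1ℚ) ((W *P constP 1ℚ) *P constP 1ℚ) +P []
      ≈⟨ ≡⇒≈ (++-identityʳ _) ⟩
    scaleP (ℚ.- 1ℚ ℚ.* 1ℚ) ((W *P constP 1ℚ) *P constP 1ℚ)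
      ≈⟨ scaleP-cong _ (≈-trans (*P-identityʳ (W *P constP 1ℚ)) (*P-identityʳ W)) ⟩
    scaleP (ℚ.- 1ℚ ℚ.* 1ℚ) W
      ≈⟨ ≡⇒≈ (cong (λ c → scaleP c W) (ℚP.*-identityʳ (ℚ.- 1ℚ))) ⟩
    scaleP (ℚ.- 1ℚ) W ∎
    where
    open ≈-Reasoning
    W = tP +P a

  +P-neg-cancel : (a p : Poly m) → a +P scaleP (ℚ.- 1ℚ) (p +P a) ≈ scaleP (ℚ.- 1ℚ) p
  +P-neg-cancel a p = mk≈ λ d e → begin
    coeff (a +P scaleP (ℚ.- 1ℚ) (p +P a)) d e                ≡⟨ coeff-++ a _ d e ⟩
    coeff a d e ℚ.+ coeff (scaleP (ℚ.- 1ℚ) (p +P a)) d e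
      ≡⟨ cong (coeff a d e ℚ.+_) (coeff-scaleP (ℚ.- 1ℚ) (p +P a) d e) ⟩
    coeff a d e ℚ.+ ℚ.- 1ℚ ℚ.* coeff (p +P a) d e
      ≡⟨ cong (λ z → coeff a d e ℚ.+ ℚ.- 1ℚ ℚ.* z) (coeff-++ p a d e) ⟩
    coeff a d e ℚ.+ ℚ.- 1ℚ ℚ.* (coeff p d e ℚ.+ coeff a d e) ≡⟨ cancel (coeff a d e) (coeff p d e) ⟩
    ℚ.- 1ℚ ℚ.* coeff p d e                                   ≡⟨ sym (coeff-scaleP (ℚ.- 1ℚ) p d e) ⟩
    coeff (scaleP (ℚ.- 1ℚ) p) d e                            ∎
    where
    open ≡-Reasoning
    open +-*-Solver
    cancel : ∀ A P → A ℚ.+ ℚ.- 1ℚ ℚ.* (P ℚ.+ A) ≡ ℚ.- 1ℚ ℚ.* P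
    cancel = solve 2 (λ A P → A :+ con (ℚ.- 1ℚ) :* (P :+ A) := con (ℚ.- 1ℚ) :* P) refl

  shift-root : (c : ℚ) (u : Vec ℕ m) → let a = (c , 0 , u) ∷ [] in shift a (a +P negP tP) ≈ negP tP
  shift-root c u = begin
    shift a (a +P negP tP)                ≈⟨ shift-+P a a (negP tP) ⟩
    shift a a +P shift a (negP tP)        ≈⟨ +P-cong (shift-const a c u) (shift-negP-tP a) ⟩
    a +P scaleP (ℚ.- 1ℚ) (tP +P a)        ≈⟨ +P-neg-cancel a tP ⟩
    negP tP                               ∎
    where
    open ≈-Reasoning
    a = (c , 0 , u) ∷ []

module _ {m : ℕ} where

  integralTerms-shift : {a p : Poly m} → IntegralTerms a → IntegralTerms p → IntegralTerms (shift a p)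
  integralTerms-shift ha hp = AllP.concat⁺ (AllP.map⁺ (All.map (λ {x} hx →
    integralTerms-scaleP hx (integralTerms-*P (integralTerms-^P (integralTerms-+P integralTerms-tP ha) (degM x))
                                              (isInteger-1 ∷ []))) hp))

  VanishesBelow : ℕ → Poly m → Set
  VanishesBelow l p = ∀ d e → d < l → coeff p d e ≡ 0ℚ

  vanishesBelow-≈ : {l : ℕ} {p q : Poly m} → p ≈ q → VanishesBelow l p → VanishesBelow l q
  vanishesBelow-≈ h z d e d<l = trans (sym (at h d e)) (z d e d<l)

  vanishesBelow-*Pʳ : {l : ℕ} (p : Poly m) {q : Poly m} → VanishesBelow l q → VanishesBelow l (p *P q)
  vanishesBelow-*Pʳ p {q} z d e d<l = trans (coeff-*P-divides p q d e) (sumQ-zero p (All.tabulate λ {a} _ →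
    trans (cong (λ w → 𝟙[ divides? a d e ]· (coefM a ℚ.* w)) (z _ _ (ℕP.≤-<-trans (ℕP.m∸n≤m d (degM a)) d<l)))
          (trans (cong (𝟙[ divides? a d e ]·_) (ℚP.*-zeroʳ (coefM a))) (𝟙-zero (divides? a d e)))))

  vanishesBelow-*Pˡ : {l : ℕ} {p : Poly m} (q : Poly m) → VanishesBelow l p → VanishesBelow l (p *P q)
  vanishesBelow-*Pˡ {p = p} q z = vanishesBelow-≈ (*P-comm q p) (vanishesBelow-*Pʳ q z)

  vanishesBelow-homogeneous : {l : ℕ} (p : Poly m) → All (λ x → degM x ≡ l) p → VanishesBelow l p
  vanishesBelow-homogeneous p hom d e d<l = trans (coeff-sumQ p d e) (sumQ-zero p (All.map (λ {x} deg≡l →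
    𝟙-no (isAt? d e x) (λ (deg≡d , _) → ℕP.<-irrefl (trans (sym deg≡d) deg≡l) d<l) (coefM x)) hom))

  homogeneous-negP-tP-^P : (l : ℕ) → All (λ x → degM x ≡ l) (negP (tP {m}) ^P l)
  homogeneous-negP-tP-^P zero = refl ∷ []
  homogeneous-negP-tP-^P (suc l) = AllP.++⁺ (AllP.map⁺ (All.map (cong suc) (homogeneous-negP-tP-^P l))) []

  ∏P : ∀ {n} → (Fin n → Poly m) → Poly m
  ∏P g = foldr _*P_ (constP 1ℚ) (toList (tabulate g))

  integralTerms-∏P : ∀ {n} (g : Fin n → Poly m) → (∀ j → IntegralTerms (g j)) → IntegralTerms (∏P g)
  integralTerms-∏P {zero} g h = isInteger-1 ∷ []
  integralTerms-∏P {suc n} g h = integralTerms-*P (h zero) (integralTerms-∏P (g ∘ suc) (h ∘ suc))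

  shift-∏P : ∀ {n} (a : Poly m) (g : Fin n → Poly m) → shift a (∏P g) ≈ ∏P (shift a ∘ g)
  shift-∏P {zero} a g = shift-const a 1ℚ (replicate m 0)
  shift-∏P {suc n} a g =
    ≈-trans (shift-*P a (g zero) (∏P (g ∘ suc))) (*P-congʳ (shift a (g zero)) (shift-∏P a (g ∘ suc)))

  vanishesBelow-∏P : ∀ {n} {l : ℕ} (g : Fin n → Poly m) (i : Fin n) → VanishesBelow l (g i) → VanishesBelow l (∏P g)
  vanishesBelow-∏P g zero h = vanishesBelow-*Pˡ {p = g zero} (∏P (g ∘ suc)) h
  vanishesBelow-∏P g (suc i) h = vanishesBelow-*Pʳ (g zero) (vanishesBelow-∏P (g ∘ suc) i h)

  DegreeAtMost : ℕ → Poly m → Set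
  DegreeAtMost a = All (λ x → degM x ≤ a)

  degreeAtMost-*P : {a b : ℕ} {p q : Poly m} → DegreeAtMost a p → DegreeAtMost b q → DegreeAtMost (a ℕ.+ b) (p *P q)
  degreeAtMost-*P [] hq = []
  degreeAtMost-*P (hx ∷ hp) hq = AllP.++⁺ (AllP.map⁺ (All.map (ℕP.+-mono-≤ hx) hq)) (degreeAtMost-*P hp hq)

  degreeAtMost-^P : {p : Poly m} → DegreeAtMost 1 p → (k : ℕ) → DegreeAtMost k (p ^P k)
  degreeAtMost-^P h zero = z≤n ∷ []
  degreeAtMost-^P h (suc k) = degreeAtMost-*P h (degreeAtMost-^P h k)

  degreeAtMost-∏P-^P : ∀ {n} (v : Vec ℕ n) (g : Fin n → Poly m) → (∀ j → DegreeAtMost 1 (g j)) →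
    DegreeAtMost (Vec.sum v) (∏P (λ j → g j ^P lookup v j))
  degreeAtMost-∏P-^P [] g h = z≤n ∷ []
  degreeAtMost-∏P-^P (k ∷ v) g h =
    degreeAtMost-*P (degreeAtMost-^P (h zero) k) (degreeAtMost-∏P-^P v (g ∘ suc) (h ∘ suc))

  degreeAtLeast-*P : {a : ℕ} {p : Poly m} (q : Poly m) → All (λ x → degM x ≡ a) p → All (λ x → a ≤ degM x) (p *P q)
  degreeAtLeast-*P q [] = []
  degreeAtLeast-*P q (refl ∷ hp) =
    AllP.++⁺ (AllP.map⁺ (All.tabulate (λ {y} _ → ℕP.m≤m+n _ (degM y)))) (degreeAtLeast-*P q hp)

module _ {m : ℕ} where

  factor : Fin (suc m) → Poly m
  factor j = alpha j +P negP tP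

  integralTerms-prodP : (l : Vec ℕ (suc m)) → IntegralTerms (prodP l)
  integralTerms-prodP l = integralTerms-∏P (λ j → factor j ^P lookup l j) (λ j →
    integralTerms-^P (integralTerms-+P (integralTerms-alpha j) (isInteger-* isInteger-−1 isInteger-1 ∷ []))
                     (lookup l j))

  degreeAtMost-factor : (j : Fin (suc m)) → DegreeAtMost 1 (factor j)
  degreeAtMost-factor zero = ℕP.≤-refl ∷ []
  degreeAtMost-factor (suc k) = z≤n ∷ ℕP.≤-refl ∷ []

  -- the lower bound comes from the first factor (α₀ − w)^l₀ = (−w)^l₀
  prodP-degrees : (l : Vec ℕ (suc m)) → All (λ x → Vec.head l ≤ degM x × degM x ≤ totalL l) (prodP l)
  prodP-degrees (l₀ ∷ l) = All.zip
    ( degreeAtLeast-*P _ (homogeneous-negP-tP-^P l₀)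
    , degreeAtMost-∏P-^P (l₀ ∷ l) factor degreeAtMost-factor )

  vanishesBelow-shift-prodP : (l : Vec ℕ (suc m)) (k : Fin m) →
    VanishesBelow (lookup l (suc k)) (shift (alpha (suc k)) (prodP l))
  vanishesBelow-shift-prodP l k = vanishesBelow-≈ (≈-sym (shift-∏P α g))
    (vanishesBelow-∏P (shift α ∘ g) (suc k)
      (vanishesBelow-≈ (≈-sym (≈-trans (shift-^P α (factor (suc k)) lₖ) (^P-cong (shift-root 1ℚ (unitVec k)) lₖ)))
        (vanishesBelow-homogeneous _ (homogeneous-negP-tP-^P lₖ))))
    where
    α = alpha (suc k)
    lₖ = lookup l (suc k)
    g : Fin (suc m) → Poly m
    g j = factor j ^P lookup l j

module _ {m : ℕ} where

  tP-^P : (k : ℕ) → tP {m} ^P k ≡ (1ℚ , k , replicate m 0) ∷ []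
  tP-^P zero = refl
  tP-^P (suc k) rewrite tP-^P k =
    cong (λ c → c ∷ []) (cong₂ (λ c u → c , suc k , u) (ℚP.*-identityˡ 1ℚ) (+v-identityˡ (replicate m 0)))

  coeff-tCoeff : (p : Poly m) (i d : ℕ) (e : Vec ℕ m) →
    coeff (tCoeff p i) d e ≡ sumQ (λ x → 𝟙[ degM x ℕ.≟ i ]· coeffM (coefM x , 0 , expM x) d e) p
  coeff-tCoeff p i d e = trans (coeff-map _ (filter (λ x → degM x ℕ.≟ i) p) d e)
                               (sumQ-filter (λ x → degM x ℕ.≟ i) _ p)

  A0-termM : ℕ → Mono m → Mono m
  A0-termM L x = (coefM x ℚ.* fact (degM x) , L ∸ degM x , expM x)

  A0-summand-term : (L i : ℕ) (x : Mono m) (d : ℕ) (e : Vec ℕ m) →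
    let D = divides? (1ℚ , L ∸ i , replicate m 0) d e
        d′ = d ∸ (L ∸ i)
        e′ = e -v replicate m 0
    in 𝟙[ D ]· (1ℚ ℚ.* (fact i ℚ.* (𝟙[ degM x ℕ.≟ i ]· coeffM (coefM x , 0 , expM x) d′ e′)))
       ≡ 𝟙[ degM x ℕ.≟ i ]· coeffM (A0-termM L x) d e
  A0-summand-term L i x d e with degM x ℕ.≟ i
  ... | no _ = trans (cong (𝟙[ D ]·_) (x*[y*0]≡0 1ℚ (fact i))) (𝟙-zero D)
    where D = divides? (1ℚ , L ∸ i , replicate m 0) d e
  ... | yes refl = begin
    𝟙[ D ]· (1ℚ ℚ.* (fact i ℚ.* (𝟙[ isAt? d′ e′ x₀ ]· coefM x)))
      ≡⟨ cong (λ z → 𝟙[ D ]· (1ℚ ℚ.* z)) (*-𝟙 (isAt? d′ e′ x₀) (fact i) (coefM x)) ⟩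
    𝟙[ D ]· (1ℚ ℚ.* (𝟙[ isAt? d′ e′ x₀ ]· (fact i ℚ.* coefM x)))
      ≡⟨ 𝟙-*-𝟙 D (isAt? d′ e′ x₀) (isAt? d e (A0-termM L x)) to from 1ℚ _ ⟩
    𝟙[ isAt? d e (A0-termM L x) ]· (1ℚ ℚ.* (fact i ℚ.* coefM x))
      ≡⟨ cong (𝟙[ isAt? d e (A0-termM L x) ]·_) (trans (ℚP.*-identityˡ _) (ℚP.*-comm (fact i) (coefM x))) ⟩
    𝟙[ isAt? d e (A0-termM L x) ]· (coefM x ℚ.* fact i) ∎
    where
    open ≡-Reasoning
    r = L ∸ i
    D = divides? (1ℚ , r , replicate m 0) d e
    d′ = d ∸ r
    e′ = e -v replicate m 0
    x₀ = (coefM x , 0 , expM x)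
    to : Divides (1ℚ , r , replicate m 0) d e → IsAt d′ e′ x₀ → IsAt d e (A0-termM L x)
    to (r+d′≡d , _) (0≡d′ , ex≡e′) = trans (sym (trans (cong (r ℕ.+_) (sym 0≡d′)) (ℕP.+-identityʳ r))) r+d′≡d
                                   , trans ex≡e′ (-v-identityʳ e)
    from : IsAt d e (A0-termM L x) → Divides (1ℚ , r , replicate m 0) d e × IsAt d′ e′ x₀
    from (refl , refl) = (ℕP.m+[n∸m]≡n ℕP.≤-refl , trans (+v-identityˡ _) (-v-identityʳ e))
                       , (sym (ℕP.n∸n≡0 r) , sym (-v-identityʳ e))

  coeff-A0-summand : (L i : ℕ) (p : Poly m) (d : ℕ) (e : Vec ℕ m) →
    coeff ((tP ^P (L ∸ i)) *P scaleP (fact i) (tCoeff p i)) d e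
      ≡ sumQ (λ x → 𝟙[ degM x ℕ.≟ i ]· coeffM (A0-termM L x) d e) p
  coeff-A0-summand L i p d e = begin
    coeff ((tP ^P (L ∸ i)) *P scaleP (fact i) (tCoeff p i)) d e
      ≡⟨ cong (λ z → coeff (z *P scaleP (fact i) (tCoeff p i)) d e) (tP-^P (L ∸ i)) ⟩
    coeff (((1ℚ , L ∸ i , replicate m 0) ∷ []) *P scaleP (fact i) (tCoeff p i)) d e
      ≡⟨ coeff-single-*P (1ℚ , L ∸ i , replicate m 0) (scaleP (fact i) (tCoeff p i)) d e ⟩
    𝟙[ D ]· (1ℚ ℚ.* coeff (scaleP (fact i) (tCoeff p i)) d′ e′)
      ≡⟨ cong (λ z → 𝟙[ D ]· (1ℚ ℚ.* z)) (trans (coeff-scaleP (fact i) (tCoeff p i) d′ e′)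
                                                (cong (fact i ℚ.*_) (coeff-tCoeff p i d′ e′))) ⟩
    𝟙[ D ]· (1ℚ ℚ.* (fact i ℚ.* sumQ σᵢ p))
      ≡⟨ cong (λ z → 𝟙[ D ]· (1ℚ ℚ.* z)) (*-sumQ (fact i) σᵢ p) ⟩
    𝟙[ D ]· (1ℚ ℚ.* sumQ (λ x → fact i ℚ.* σᵢ x) p)
      ≡⟨ cong (𝟙[ D ]·_) (*-sumQ 1ℚ _ p) ⟩
    𝟙[ D ]· sumQ (λ x → 1ℚ ℚ.* (fact i ℚ.* σᵢ x)) p
      ≡⟨ 𝟙-sumQ D _ p ⟩
    sumQ (λ x → 𝟙[ D ]· (1ℚ ℚ.* (fact i ℚ.* σᵢ x))) p
      ≡⟨ sumQ-cong (λ x → A0-summand-term L i x d e) p ⟩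
    sumQ (λ x → 𝟙[ degM x ℕ.≟ i ]· coeffM (A0-termM L x) d e) p ∎
    where
    open ≡-Reasoning
    D = divides? (1ℚ , L ∸ i , replicate m 0) d e
    d′ = d ∸ (L ∸ i)
    e′ = e -v replicate m 0
    σᵢ : Mono m → ℚ
    σᵢ x = 𝟙[ degM x ℕ.≟ i ]· coeffM (coefM x , 0 , expM x) d′ e′

-- In Σ_{i ∈ [l₀, L]} t^(L ∸ i) i! σ_i each monomial x of P contributes exactly once, at i = deg x.
A0≈map-A0-termM : ∀ {m} (l : Vec ℕ (suc m)) → A0 l ≈ map (A0-termM (totalL l)) (prodP l)
A0≈map-A0-termM {m} l = mk≈ λ d e → begin
  coeff (A0 l) d e                                              ≡⟨ coeff-sumP (map T (range l₀ L)) d e ⟩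
  sumQ (λ q → coeff q d e) (map T (range l₀ L))                 ≡⟨ sumQ-map _ T (range l₀ L) ⟩
  sumQ (λ i → coeff (T i) d e) (range l₀ L)
    ≡⟨ sumQ-cong (λ i → coeff-A0-summand L i P d e) (range l₀ L) ⟩
  sumQ (λ i → sumQ (λ x → 𝟙[ degM x ℕ.≟ i ]· coeffM (A0-termM L x) d e) P) (range l₀ L)
    ≡⟨ sumQ-swap (λ i x → 𝟙[ degM x ℕ.≟ i ]· coeffM (A0-termM L x) d e) (range l₀ L) P ⟩
  sumQ (λ x → sumQ (λ i → 𝟙[ degM x ℕ.≟ i ]· coeffM (A0-termM L x) d e) (range l₀ L)) P
    ≡⟨ sumQ-cong-All P (All.map (λ (lo , hi) → sumQ-range-𝟙 lo hi _) (prodP-degrees l)) ⟩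
  sumQ (λ x → coeffM (A0-termM L x) d e) P                      ≡⟨ sym (coeff-map (A0-termM L) P d e) ⟩
  coeff (map (A0-termM L) P) d e ∎
  where
  open ≡-Reasoning
  L = totalL l
  l₀ = Vec.head l
  P = prodP l
  T : ℕ → Poly m
  T i = (tP ^P (L ∸ i)) *P scaleP (fact i) (sigma l i)

module _ {m : ℕ} where

  coeff-tP-*P-zero : (q : Poly m) (v : Vec ℕ m) → coeff (tP *P q) 0 v ≡ 0ℚ
  coeff-tP-*P-zero q v = trans (coeff-single-*P t q 0 v) (𝟙-no (divides? t 0 v) (λ ()) (1ℚ ℚ.* coeff q 0 (v -v replicate m 0)))
    where t = (1ℚ , 1 , replicate m 0)

  coeff-tP-*P-suc : (q : Poly m) (s : ℕ) (v : Vec ℕ m) → coeff (tP *P q) (suc s) v ≡ coeff q s v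
  coeff-tP-*P-suc q s v = begin
    coeff (tP *P q) (suc s) v
      ≡⟨ coeff-single-*P (1ℚ , 1 , replicate m 0) q (suc s) v ⟩
    𝟙[ D ]· (1ℚ ℚ.* coeff q s (v -v replicate m 0))
      ≡⟨ 𝟙-yes D (refl , trans (+v-identityˡ _) (-v-identityʳ v)) _ ⟩
    1ℚ ℚ.* coeff q s (v -v replicate m 0)                          ≡⟨ ℚP.*-identityˡ _ ⟩
    coeff q s (v -v replicate m 0)                                  ≡⟨ cong (coeff q s) (-v-identityʳ v) ⟩
    coeff q s v ∎
    where
    open ≡-Reasoning
    D = divides? (1ℚ , 1 , replicate m 0) (suc s) v

  coeff-const-*P : (c : ℚ) (u : Vec ℕ m) (q : Poly m) (s : ℕ) (v w : Vec ℕ m) (r : ℚ) →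
    coeff q s (v -v u) ≡ 𝟙[ ≡-dec ℕ._≟_ (v -v u) w ]· r →
    coeff (((c , 0 , u) ∷ []) *P q) s v ≡ 𝟙[ ≡-dec ℕ._≟_ v (u +v w) ]· (c ℚ.* r)
  coeff-const-*P c u q s v w r h = begin
    coeff (((c , 0 , u) ∷ []) *P q) s v                 ≡⟨ coeff-single-*P (c , 0 , u) q s v ⟩
    𝟙[ divides? (c , 0 , u) s v ]· (c ℚ.* coeff q s (v -v u))
      ≡⟨ cong (λ z → 𝟙[ divides? (c , 0 , u) s v ]· (c ℚ.* z)) h ⟩
    𝟙[ divides? (c , 0 , u) s v ]· (c ℚ.* (𝟙[ ≡-dec ℕ._≟_ (v -v u) w ]· r))
      ≡⟨ 𝟙-*-𝟙 (divides? (c , 0 , u) s v) (≡-dec ℕ._≟_ (v -v u) w) (≡-dec ℕ._≟_ v (u +v w)) to from c r ⟩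
    𝟙[ ≡-dec ℕ._≟_ v (u +v w) ]· (c ℚ.* r) ∎
    where
    open ≡-Reasoning
    to : Divides (c , 0 , u) s v → v -v u ≡ w → v ≡ u +v w
    to (_ , split) v-u≡w = ∸v⇒≡+v u w v split (sym v-u≡w)
    from : v ≡ u +v w → Divides (c , 0 , u) s v × v -v u ≡ w
    from v≡u+w with ≡+v⇒∸v u w v v≡u+w
    ... | split , w≡v-u = (refl , split) , sym w≡v-u

  coeff-binomial : (u : Vec ℕ m) (i s : ℕ) (v : Vec ℕ m) →
    coeff ((tP +P ((1ℚ , 0 , u) ∷ [])) ^P i) s v ≡ 𝟙[ ≡-dec ℕ._≟_ v ((i ∸ s) ·v u) ]· choose i s
  coeff-binomial u zero zero v = trans (coeff-single (1ℚ , 0 , replicate m 0) 0 v)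
    (𝟙-cong (isAt? 0 v (1ℚ , 0 , replicate m 0)) (≡-dec ℕ._≟_ v (replicate m 0))
            (λ (_ , 0≡v) → sym 0≡v) (λ v≡0 → refl , sym v≡0) (λ _ → refl))
  coeff-binomial u zero (suc s) v = begin
    coeff (constP 1ℚ) (suc s) v                         ≡⟨ coeff-single (1ℚ , 0 , replicate m 0) (suc s) v ⟩
    𝟙[ isAt? (suc s) v (1ℚ , 0 , replicate m 0) ]· 1ℚ
      ≡⟨ 𝟙-no (isAt? (suc s) v (1ℚ , 0 , replicate m 0)) (λ { (() , _) }) 1ℚ ⟩
    0ℚ                                                  ≡⟨ sym (𝟙-zero (≡-dec ℕ._≟_ v (replicate m 0))) ⟩
    𝟙[ ≡-dec ℕ._≟_ v (replicate m 0) ]· 0ℚ             ∎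
    where open ≡-Reasoning
  coeff-binomial u (suc i) s v =
    trans (at (*P-distribʳ tP a X) s v) (trans (coeff-++ (tP *P X) (a *P X) s v) (step s))
    where
    open ≡-Reasoning
    a = (1ℚ , 0 , u) ∷ []
    X = (tP +P a) ^P i
    _≟v_ = ≡-dec ℕ._≟_
    a*X : ∀ s → coeff (a *P X) s v ≡ 𝟙[ v ≟v (u +v (i ∸ s) ·v u) ]· (1ℚ ℚ.* choose i s)
    a*X s = coeff-const-*P 1ℚ u X s v _ _ (coeff-binomial u i s (v -v u))
    a*X-suc : ∀ s → coeff (a *P X) (suc s) v ≡ 𝟙[ v ≟v ((i ∸ s) ·v u) ]· choose i (suc s)
    a*X-suc s with s ℕ.<? i
    ... | yes s<i = trans (a*X (suc s)) (𝟙-cong (v ≟v _) (v ≟v _)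
      (λ h → trans h (sym exps)) (λ h → trans h exps) (λ _ → ℚP.*-identityˡ _))
      where
      exps : (i ∸ s) ·v u ≡ u +v (i ∸ suc s) ·v u
      exps = cong (_·v u) (ℕP.+-∸-assoc 1 s<i)
    ... | no s≮i = begin
      coeff (a *P X) (suc s) v                                         ≡⟨ a*X (suc s) ⟩
      𝟙[ v ≟v (u +v (i ∸ suc s) ·v u) ]· (1ℚ ℚ.* choose i (suc s))
        ≡⟨ cong (λ c → 𝟙[ v ≟v (u +v (i ∸ suc s) ·v u) ]· (1ℚ ℚ.* c)) C≡0 ⟩
      𝟙[ v ≟v (u +v (i ∸ suc s) ·v u) ]· (1ℚ ℚ.* 0ℚ)                   ≡⟨ 𝟙-zero (v ≟v (u +v (i ∸ suc s) ·v u)) ⟩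
      0ℚ                                                               ≡⟨ sym (𝟙-zero (v ≟v ((i ∸ s) ·v u))) ⟩
      𝟙[ v ≟v ((i ∸ s) ·v u) ]· 0ℚ
        ≡⟨ cong (𝟙[ v ≟v ((i ∸ s) ·v u) ]·_) (sym C≡0) ⟩
      𝟙[ v ≟v ((i ∸ s) ·v u) ]· choose i (suc s)                       ∎
      where
      C≡0 : choose i (suc s) ≡ 0ℚ
      C≡0 = choose-> i (suc s) (s≤s (ℕP.≮⇒≥ s≮i))
    step : ∀ s → coeff (tP *P X) s v ℚ.+ coeff (a *P X) s v ≡ 𝟙[ v ≟v ((suc i ∸ s) ·v u) ]· choose (suc i) s
    step zero = trans (cong₂ ℚ._+_ (coeff-tP-*P-zero X v) (a*X 0))
                      (trans (ℚP.+-identityˡ _) (cong (𝟙[ v ≟v ((suc i) ·v u) ]·_) (ℚP.*-identityˡ _)))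
    step (suc s) = begin
      coeff (tP *P X) (suc s) v ℚ.+ coeff (a *P X) (suc s) v
        ≡⟨ cong₂ ℚ._+_ (trans (coeff-tP-*P-suc X s v) (coeff-binomial u i s v)) (a*X-suc s) ⟩
      𝟙[ v ≟v ((i ∸ s) ·v u) ]· choose i s ℚ.+ 𝟙[ v ≟v ((i ∸ s) ·v u) ]· choose i (suc s)
        ≡⟨ 𝟙-+ (v ≟v _) _ _ ⟩
      𝟙[ v ≟v ((i ∸ s) ·v u) ]· (choose i s ℚ.+ choose i (suc s))
        ≡⟨ cong (𝟙[ v ≟v ((i ∸ s) ·v u) ]·_) (choose-pascal i s) ⟩
      𝟙[ v ≟v ((i ∸ s) ·v u) ]· choose (suc i) (suc s) ∎

  coeff-shiftM : (u : Vec ℕ m) (x : Mono m) (s : ℕ) (e : Vec ℕ m) →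
    coeff (shiftM ((1ℚ , 0 , u) ∷ []) x) s e
      ≡ 𝟙[ ≡-dec ℕ._≟_ e (expM x +v (degM x ∸ s) ·v u) ]· (coefM x ℚ.* choose (degM x) s)
  coeff-shiftM u x s e = begin
    coeff (scaleP (coefM x) (W *P Eˣ)) s e           ≡⟨ coeff-scaleP (coefM x) (W *P Eˣ) s e ⟩
    coefM x ℚ.* coeff (W *P Eˣ) s e                  ≡⟨ cong (coefM x ℚ.*_) (at (*P-comm W Eˣ) s e) ⟩
    coefM x ℚ.* coeff (Eˣ *P W) s e
      ≡⟨ cong (coefM x ℚ.*_) (coeff-const-*P 1ℚ (expM x) W s e _ _ (coeff-binomial u (degM x) s (e -v expM x))) ⟩
    coefM x ℚ.* 𝟙[ D ]· (1ℚ ℚ.* choose (degM x) s)   ≡⟨ *-𝟙 D (coefM x) _ ⟩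
    𝟙[ D ]· (coefM x ℚ.* (1ℚ ℚ.* choose (degM x) s)) ≡⟨ cong (λ z → 𝟙[ D ]· (coefM x ℚ.* z)) (ℚP.*-identityˡ _) ⟩
    𝟙[ D ]· (coefM x ℚ.* choose (degM x) s) ∎
    where
    open ≡-Reasoning
    W = (tP +P ((1ℚ , 0 , u) ∷ [])) ^P degM x
    Eˣ = (1ℚ , 0 , expM x) ∷ []
    D = ≡-dec ℕ._≟_ e (expM x +v (degM x ∸ s) ·v u)

+[∸]≡⇒ : {i L n k : ℕ} → i ≤ L → n ≤ L → k ℕ.+ (L ∸ i) ≡ n → L ∸ n ≤ i × k ≡ i ∸ (L ∸ n)
+[∸]≡⇒ {i} {L} {n} {k} i≤L n≤L refl =
  subst (_≤ i) (sym L∸n≡i∸k) (ℕP.m∸n≤m i k) , sym (trans (cong (i ∸_) L∸n≡i∸k) (ℕP.m∸[m∸n]≡n k≤i))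
  where
  r = L ∸ i
  L≡r+i : L ≡ r ℕ.+ i
  L≡r+i = sym (trans (ℕP.+-comm r i) (ℕP.m+[n∸m]≡n i≤L))
  k≤i : k ≤ i
  k≤i = ℕP.+-cancelˡ-≤ r k i (subst₂ _≤_ (ℕP.+-comm k r) L≡r+i n≤L)
  L∸n≡i∸k : L ∸ (k ℕ.+ r) ≡ i ∸ k
  L∸n≡i∸k = trans (cong₂ _∸_ L≡r+i (ℕP.+-comm k r)) (ℕP.[m+n]∸[m+o]≡n∸o r i k)

∸+[∸]≡ : {i L n : ℕ} → i ≤ L → n ≤ L → L ∸ n ≤ i → (i ∸ (L ∸ n)) ℕ.+ (L ∸ i) ≡ n
∸+[∸]≡ {i} {L} {n} i≤L n≤L s≤i = begin
  (i ∸ (L ∸ n)) ℕ.+ (L ∸ i) ≡⟨ sym (ℕP.+-∸-comm (L ∸ i) s≤i) ⟩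
  (i ℕ.+ (L ∸ i)) ∸ (L ∸ n) ≡⟨ cong (_∸ (L ∸ n)) (ℕP.m+[n∸m]≡n i≤L) ⟩
  L ∸ (L ∸ n)               ≡⟨ ℕP.m∸[m∸n]≡n n≤L ⟩
  n                         ∎
  where open ≡-Reasoning

module _ {m : ℕ} (u : Vec ℕ m) where

  private
    a : Poly m
    a = (1ℚ , 0 , u) ∷ []

  αt-^P : (k : ℕ) → (a *P tP) ^P k ≡ (1ℚ , k , k ·v u) ∷ []
  αt-^P zero = refl
  αt-^P (suc k) rewrite αt-^P k = cong (λ c → c ∷ [])
    (cong₂ (λ c v → c , suc k , v) (trans (ℚP.*-identityʳ _) (ℚP.*-identityˡ 1ℚ))
                                   (cong (_+v k ·v u) (+v-identityʳ u)))

  expTrunc-term : (k : ℕ) → scaleP (invFact k) ((a *P tP) ^P k) ≡ (invFact k , k , k ·v u) ∷ []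
  expTrunc-term k rewrite αt-^P k = cong (λ c → (c , k , k ·v u) ∷ []) (ℚP.*-identityʳ (invFact k))

  coeff-expTrunc-*P-single : (N : ℕ) (y : Mono m) (n : ℕ) (e : Vec ℕ m) →
    coeff (expTrunc N a *P (y ∷ [])) n e ≡ sumQ (λ k → coeffM ((invFact k , k , k ·v u) *M y) n e) (upTo (suc N))
  coeff-expTrunc-*P-single N y n e = begin
    coeff (expTrunc N a *P (y ∷ [])) n e                    ≡⟨ coeff-sumP-*P (map term (upTo (suc N))) (y ∷ []) n e ⟩
    sumQ (λ p → coeff (p *P (y ∷ [])) n e) (map term (upTo (suc N)))
      ≡⟨ sumQ-map (λ p → coeff (p *P (y ∷ [])) n e) term (upTo (suc N)) ⟩
    sumQ (λ k → coeff (term k *P (y ∷ [])) n e) (upTo (suc N))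
      ≡⟨ sumQ-cong (λ k → trans (cong (λ p → coeff (p *P (y ∷ [])) n e) (expTrunc-term k))
                                (coeff-single ((invFact k , k , k ·v u) *M y) n e)) (upTo (suc N)) ⟩
    sumQ (λ k → coeffM ((invFact k , k , k ·v u) *M y) n e) (upTo (suc N)) ∎
    where
    open ≡-Reasoning
    term : ℕ → Poly m
    term k = scaleP (invFact k) ((a *P tP) ^P k)

  -- Only the k = i ∸ s term of e^{αt} contributes, and i! / (i ∸ s)! = s! · C(i, s).
  coeff-expTrunc-*P-A0-termM : (L : ℕ) (x : Mono m) (n : ℕ) (e : Vec ℕ m) → degM x ≤ L → n ≤ L →
    coeff (expTrunc L a *P (A0-termM L x ∷ [])) n e ≡ fact (L ∸ n) ℚ.* coeff (shiftM a x) (L ∸ n) e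
  coeff-expTrunc-*P-A0-termM L x n e i≤L n≤L = begin
    coeff (expTrunc L a *P (A0-termM L x ∷ [])) n e        ≡⟨ coeff-expTrunc-*P-single L (A0-termM L x) n e ⟩
    sumQ term (upTo (suc L))                               ≡⟨ pick (s ℕ.≤? i) ⟩
    𝟙[ E ]· (fact s ℚ.* (coefM x ℚ.* choose i s))          ≡⟨ sym (*-𝟙 E (fact s) _) ⟩
    fact s ℚ.* (𝟙[ E ]· (coefM x ℚ.* choose i s))          ≡⟨ cong (fact s ℚ.*_) (sym (coeff-shiftM u x s e)) ⟩
    fact s ℚ.* coeff (shiftM a x) s e                      ∎
    where
    open ≡-Reasoning
    i = degM x
    s = L ∸ n
    E = ≡-dec ℕ._≟_ e (expM x +v (i ∸ s) ·v u)
    z : ℕ → Mono m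
    z k = (invFact k , k , k ·v u)
    term : ℕ → ℚ
    term k = coeffM (z k *M A0-termM L x) n e
    off : ∀ k → k ≢ i ∸ s → term k ≡ 0ℚ
    off k k≢j = 𝟙-no (isAt? n e (z k *M A0-termM L x)) (λ (deg≡n , _) → k≢j (proj₂ (+[∸]≡⇒ i≤L n≤L deg≡n))) _
    pick : Dec (s ≤ i) → sumQ term (upTo (suc L)) ≡ 𝟙[ E ]· (fact s ℚ.* (coefM x ℚ.* choose i s))
    pick (yes s≤i) = trans (sumQ-applyUpTo-single (λ k → k) term (suc L) (i ∸ s) (s≤s (ℕP.≤-trans (ℕP.m∸n≤m i s) i≤L))
                                                  off)
      (𝟙-cong (isAt? n e (z (i ∸ s) *M A0-termM L x)) E
        (λ (_ , exp≡e) → trans (sym exp≡e) (+v-comm _ (expM x)))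
        (λ e≡exp → ∸+[∸]≡ i≤L n≤L s≤i , trans (+v-comm _ (expM x)) (sym e≡exp))
        (λ _ → invFact*fact≡fact*choose s≤i (coefM x)))
    pick (no s≰i) = trans (sumQ-zero (upTo (suc L)) (All.tabulate (λ {k} _ →
        𝟙-no (isAt? n e (z k *M A0-termM L x)) (λ (deg≡n , _) → s≰i (proj₁ (+[∸]≡⇒ i≤L n≤L deg≡n))) _)))
      (sym (trans (cong (λ c → 𝟙[ E ]· (fact s ℚ.* (coefM x ℚ.* c))) (choose-> i s (ℕP.≰⇒> s≰i)))
             (trans (cong (𝟙[ E ]·_) (x*[y*0]≡0 (fact s) (coefM x))) (𝟙-zero E))))

A0-scaled-integral : ∀ {m} (l : Vec ℕ (suc m)) → InZPoly (scaleP (invFact (Vec.head l)) (A0 l))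
A0-scaled-integral l = InZPoly-≈ (scaleP-cong (invFact l₀) (≈-sym (A0≈map-A0-termM l)))
  (integralTerms⇒InZPoly (AllP.map⁺ (AllP.map⁺ terms)))
  where
  l₀ = Vec.head l
  integral : ∀ {x} → IsInteger (coefM x) × (l₀ ≤ degM x × degM x ≤ totalL l) →
             IsInteger (invFact l₀ ℚ.* (coefM x ℚ.* fact (degM x)))
  integral {x} (c-int , l₀≤i , _) = isInteger-cong (sym (x∙yz≈y∙xz (invFact l₀) (coefM x) (fact (degM x))))
    (isInteger-* c-int (isInteger-invFact*fact l₀≤i))
  terms : All (λ x → IsInteger (invFact l₀ ℚ.* (coefM x ℚ.* fact (degM x)))) (prodP l)
  terms = All.map (λ {x} → integral {x}) (All.zip (integralTerms-prodP l , prodP-degrees l))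

coeff-expTrunc-*P-A0 : ∀ {m} (l : Vec ℕ (suc m)) (u : Vec ℕ m) (d : ℕ) (e : Vec ℕ m) → d ≤ totalL l →
  let L = totalL l ; a = (1ℚ , 0 , u) ∷ [] in
  coeff (expTrunc L a *P A0 l) d e ≡ fact (L ∸ d) ℚ.* coeff (shift a (prodP l)) (L ∸ d) e
coeff-expTrunc-*P-A0 l u d e d≤L = begin
  coeff (E *P A0 l) d e                                   ≡⟨ at (*P-congʳ E (A0≈map-A0-termM l)) d e ⟩
  coeff (E *P map (A0-termM L) P) d e                     ≡⟨ coeff-*P-map (A0-termM L) E P d e ⟩
  sumQ (λ x → coeff (E *P (A0-termM L x ∷ [])) d e) P
    ≡⟨ sumQ-cong-All P (All.map (λ {x} (_ , i≤L) → coeff-expTrunc-*P-A0-termM u L x d e i≤L d≤L) (prodP-degrees l)) ⟩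
  sumQ (λ x → fact s ℚ.* coeff (shiftM a x) s e) P        ≡⟨ sym (*-sumQ (fact s) _ P) ⟩
  fact s ℚ.* sumQ (λ x → coeff (shiftM a x) s e) P
    ≡⟨ cong (fact s ℚ.*_) (sym (coeff-concatMap (shiftM a) P s e)) ⟩
  fact s ℚ.* coeff (shift a P) s e                        ∎
  where
  open ≡-Reasoning
  L = totalL l
  a = (1ℚ , 0 , u) ∷ []
  E = expTrunc L a
  P = prodP l
  s = L ∸ d

Aⱼ-scaled-integral : ∀ {m} (l : Vec ℕ (suc m)) (k : Fin m) →
  InZPoly (scaleP (invFact (lookup l (suc k))) (A l (suc k)))
Aⱼ-scaled-integral l k d e = isInteger-cong (sym (coeff-scaleP (invFact lⱼ) (A l (suc k)) d e)) (by-degree (d ℕ.≤? L))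
  where
  L = totalL l
  lⱼ = lookup l (suc k)
  α = alpha (suc k)
  Eα*A0 = expTrunc L α *P A0 l
  s = L ∸ d
  c = coeff (shift α (prodP l)) s e
  c-integral : IsInteger c
  c-integral = integralTerms⇒InZPoly (integralTerms-shift (integralTerms-alpha (suc k)) (integralTerms-prodP l)) s e
  -- s ≥ lⱼ gives lⱼ! ∣ s!; otherwise c vanishes because (−w)^lⱼ divides P(w + αⱼ)
  by-order : Dec (lⱼ ≤ s) → IsInteger (invFact lⱼ ℚ.* (fact s ℚ.* c))
  by-order (yes lⱼ≤s) = isInteger-cong (ℚP.*-assoc (invFact lⱼ) (fact s) c)
    (isInteger-* (isInteger-invFact*fact lⱼ≤s) c-integral)
  by-order (no lⱼ≰s) = isInteger-cong (sym (trans (cong (λ z → invFact lⱼ ℚ.* (fact s ℚ.* z))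
      (vanishesBelow-shift-prodP l k s e (ℕP.≰⇒> lⱼ≰s)))
      (x*[y*0]≡0 (invFact lⱼ) (fact s)))) isInteger-0
  by-degree : Dec (d ≤ L) → IsInteger (invFact lⱼ ℚ.* coeff (A l (suc k)) d e)
  by-degree (yes d≤L) = isInteger-cong
    (sym (cong (invFact lⱼ ℚ.*_)
      (trans (coeff-truncP-≤ L Eα*A0 d e d≤L) (coeff-expTrunc-*P-A0 l (unitVec k) d e d≤L))))
    (by-order (lⱼ ℕ.≤? s))
  by-degree (no d≰L) = isInteger-cong
    (sym (trans (cong (invFact lⱼ ℚ.*_) (coeff-truncP-> L Eα*A0 d e d≰L)) (ℚP.*-zeroʳ (invFact lⱼ)))) isInteger-0

lemma4p3 : (m : ℕ) → 1 ≤ m → (l : Vec ℕ (suc m)) →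
    (∀ (i : Fin (suc m)) → 1 ≤ lookup l i) →
    ∀ (j : Fin (suc m)) → InZPoly (scaleP (invFact (lookup l j)) (A l j))
lemma4p3 m _ (l₀ ∷ l) _ zero = A0-scaled-integral (l₀ ∷ l)
lemma4p3 m _ l _ (suc k) = Aⱼ-scaled-integral l k
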